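{- Let $\big(G(L)=(V,E,L),s,t,c\big)$ be a temporal flow network in which every node has an unbounded (infinite) buffer. Then the maximum value $\max_f v(f)$ of a temporal flow in $G(L)$ equals the minimum capacity of a (minimal) temporal cut separating $s$ and $t$.
   Context: A temporal graph $G(L)=(V,E,L)$ consists of a finite directed graph $G=(V,E)$ and a labelling assigning to each edge $e$ a finite set $L_e\subseteq\mathbb{N}$ of positive integer labels (days of availability). A time edge is a triple $(u,v,l)$ (also $(e,l)$) with $e=(u,v)\in E$, $l\in L_e$; $E_L$ is the set of time edges. A journey from $u$ to $v$ is a sequence of time edges $(u,u_1,l_1),(u_1,u_2,l_2),\dots,(u_{k-1},v,l_k)$ with $l_1<l_2<\dots<l_k$. The network has source $s$ and sink $t$ (no edge enters $s$, none leaves $t$), and edge capacities $c(e)>0$. A temporal flow consists of non-negative reals $f(e,l)$ and buffer contents $b_u^-(l),b_u^\mu(l),b_u^+(l)\ge 0$ for nodes $u$ and $l\in L_R(u)=\{0\}\cup\bigcup_{e \text{ incident to } u}L_e$, such that $0\le f(e,l)\le c(e)$, $f(e,l)=0$ if $l=0$ or $l\notin L_e$, an infinite amount of flow is available at $s$ at time $0$, and for every $v\ne s$: $b_v^\pm(0)=b_v^\mu(0)=0$, and for each label $l>0$ in $L_R(v)$, $b_v^-(l)=b_v^+(l_{prev})$ ($l_{prev}$ the previous element of $L_R(v)$), $b_v^\mu(l)=b_v^-(l)-\sum_{e \text{ out of } v}f(e,l)$, $b_v^+(l)=b_v^\mu(l)+\sum_{e\text{ into }v}f(e,l)$. The value $v(f)$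 is $b_t^+(l_{max})$, $l_{max}$ the maximum label. A temporal cut is a set $S$ of time edges whose removal leaves no $s\to t$ journey; it is minimal if no proper subset is a temporal cut; its capacity is $c(S)=\sum_{(e,l)\in S}c(e)$.
   Formalization: The edge capacities $c(e)$ are rational, and the flow values $f(e,l)$ and the buffer contents take values in ℚ instead of the reals. -}

module Defs where

open import Data.Nat as ℕ using (ℕ; zero; suc; _⊔_)
open import Data.Fin using (Fin; zero; suc; _≟_)
open import Data.Rational as ℚ using (ℚ; 0ℚ)
open import Data.List using (List; []; _∷_; foldr; map)
open import Data.List.Membership.Propositional using (_∈_; _∉_)
open import Data.List.Relation.Unary.All using (All)
open import Data.List.Relation.Unary.Unique.Propositional using (Unique)
open import Data.Product using (Σ; ∃; ∃-syntax; _×_; _,_)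
open import Data.Sum using (_⊎_)
open import Relation.Binary.PropositionalEquality using (_≡_; _≢_)
open import Relation.Nullary using (¬_; yes; no)

ΣFin : (k : ℕ) → (Fin k → ℚ) → ℚ
ΣFin zero    g = 0ℚ
ΣFin (suc k) g = g zero ℚ.+ ΣFin k (λ i → g (suc i))

record TemporalNetwork : Set where
  field
    n m       : ℕ
    src tgt   : Fin m → Fin n
    s t       : Fin n
    s≢t       : s ≢ t
    noIntoS   : ∀ e → tgt e ≢ s
    noOutOfT  : ∀ e → src e ≢ t
    L         : Fin m → List ℕ
    L-pos     : ∀ e → All (λ l → 0 ℕ.< l) (L e)
    c         : Fin m → ℚ
    c-pos     : ∀ e → 0ℚ ℚ.< c e

module _ (N : TemporalNetwork) where
  open TemporalNetwork N

  TimeEdge : Set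
  TimeEdge = Fin m × ℕ

  IsTimeEdge : TimeEdge → Set
  IsTimeEdge (e , l) = l ∈ L e

  _∈LR_ : ℕ → Fin n → Set
  l ∈LR v = l ≡ 0 ⊎ Σ (Fin m) (λ e → (src e ≡ v ⊎ tgt e ≡ v) × l ∈ L e)

  lmax : ℕ
  lmax = ΣFinMax m (λ e → foldr _⊔_ 0 (L e))
    where
    ΣFinMax : (k : ℕ) → (Fin k → ℕ) → ℕ
    ΣFinMax zero    g = 0
    ΣFinMax (suc k) g = g zero ⊔ ΣFinMax k (λ i → g (suc i))

  inflow : (Fin m → ℕ → ℚ) → Fin n → ℕ → ℚ
  inflow f v l = ΣFin m (λ e → case-eq (tgt e) (f e l))
    where
    case-eq : Fin n → ℚ → ℚ
    case-eq w q with w ≟ v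
    ... | yes _ = q
    ... | no  _ = 0ℚ

  outflow : (Fin m → ℕ → ℚ) → Fin n → ℕ → ℚ
  outflow f v l = ΣFin m (λ e → case-eq (src e) (f e l))
    where
    case-eq : Fin n → ℚ → ℚ
    case-eq w q with w ≟ v
    ... | yes _ = q
    ... | no  _ = 0ℚ

  -- Buffer functions are given at every time
  -- l ∈ ℕ (the recursion b⁻(l) = b⁺(l-1) on ℕ agrees with
  -- b⁻(l) = b⁺(l_prev) on L_R(v), since no flow moves at non-labels).
  -- The source has an infinite buffer, so no constraint is imposed there.
  record TemporalFlow : Set where
    field
      f           : Fin m → ℕ → ℚ
      b⁻ bμ b⁺    : Fin n → ℕ → ℚ
      f-nonneg    : ∀ e l → 0ℚ ℚ.≤ f e l
      f-cap       : ∀ e l → f e l ℚ.≤ c e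
      f-zero      : ∀ e l → (l ≡ 0 ⊎ l ∉ L e) → f e l ≡ 0ℚ
      b-init      : ∀ v → v ≢ s → b⁻ v 0 ≡ 0ℚ × bμ v 0 ≡ 0ℚ × b⁺ v 0 ≡ 0ℚ
      b-step      : ∀ v → v ≢ s → ∀ l →
                      b⁻ v (suc l) ≡ b⁺ v l
                    × bμ v (suc l) ≡ b⁻ v (suc l) ℚ.- outflow f v (suc l)
                    × b⁺ v (suc l) ≡ bμ v (suc l) ℚ.+ inflow f v (suc l)
      b-nonneg    : ∀ v → v ≢ s → ∀ l → l ∈LR v →
                      0ℚ ℚ.≤ b⁻ v l × 0ℚ ℚ.≤ bμ v l × 0ℚ ℚ.≤ b⁺ v l

  value : TemporalFlow → ℚ
  value F = TemporalFlow.b⁺ F t lmax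

  data JourneyToT : Fin n → ℕ → List TimeEdge → Set where
    arrive : ∀ {l} → JourneyToT t l []
    step   : ∀ {u l e l' js} → src e ≡ u → l' ∈ L e → l ℕ.< l' →
             JourneyToT (tgt e) l' js → JourneyToT u l ((e , l') ∷ js)

  -- s–t journeys (labels are positive, so bound 0 is no restriction)
  Journey-st : List TimeEdge → Set
  Journey-st js = JourneyToT s 0 js

  TimeEdgeSet : List TimeEdge → Set
  TimeEdgeSet S = Unique S × All IsTimeEdge S

  IsTemporalCut : List TimeEdge → Set
  IsTemporalCut S = TimeEdgeSet S ×
    (∀ js → Journey-st js → ∃[ x ] (x ∈ js × x ∈ S))

  ProperSubset : List TimeEdge → List TimeEdge → Set
  ProperSubset S' S = (∀ {x} → x ∈ S' → x ∈ S) × ∃[ x ] (x ∈ S × x ∉ S')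

  IsMinimalTemporalCut : List TimeEdge → Set
  IsMinimalTemporalCut S = IsTemporalCut S ×
    (∀ S' → TimeEdgeSet S' → ProperSubset S' S → ¬ IsTemporalCut S')

  capacity : List TimeEdge → ℚ
  capacity S = foldr (λ x acc → c (Data.Product.proj₁ x) ℚ.+ acc) 0ℚ S

{-# OPTIONS --safe #-}
-- Weak duality: for a cut S let α v l indicate that t can still be reached from v after time l
-- avoiding S, and let Φ l be the sum of the buffers b⁺ v l weighted by α.  Φ starts at 0, ends at
-- the value, and in each time step grows by at most the capacity of the time edges of S at that
-- step, because buffers only lose weight where α drops, i.e. at labels of out-edges, where they
-- are nonnegative.
--
-- Strong duality: all capacities are integer multiples of a common unit u.  Ford–Fulkerson in the
-- time-expanded residual network (waiting arcs of unbounded capacity, backward waiting arcs where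
-- a buffer holds u, and forward and backward arcs of the time edges) augments by u along simple
-- paths, so flows stay multiples of u, and terminates as the value is bounded by the capacity of
-- all time edges.  Once (t , lmax) is unreachable, the time edges leaving the reachable states
-- form a cut; with α the indicator of unreachability, crossing edges are saturated, backward
-- edges and buffers entering the reachable set are empty, and the same telescoping gives equality.
-- A minimum cut is minimal because capacities are positive.
module Submission where

open import Defs
open import Data.Rational using (_≤_)
open import Relation.Binary.PropositionalEquality using (_≡_)
open import Data.Product using (Σ; _×_)
open import Data.List using (List)

open import Algebra.Bundles using (Ring)
open import Data.Empty using (⊥-elim)
open import Data.Fin using (Fin; zero; suc; _≟_; toℕ; fromℕ<)
import Data.Fin.Properties as Fin
open import Data.Integer as ℤ using (ℤ)
import Data.Integer.Properties as ℤ
open import Data.List using ([]; _∷_; foldr; length; cartesianProduct; allFin; upTo; filter)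
open import Data.List.Membership.Propositional using (_∈_; _∉_; _─_; lose; find)
open import Data.List.Membership.Propositional.Properties using (∈-cartesianProduct⁺; ∈-allFin; ∈-upTo⁺; ∈-filter⁺; ∈-filter⁻)
open import Data.List.Properties using (length-removeAt′)
import Data.List.Relation.Unary.All as All
open import Data.List.Relation.Unary.All using (All; []; _∷_)
open import Data.List.Relation.Unary.All.Properties using (All¬⇒¬Any; ¬Any⇒All¬)
import Data.List.Relation.Unary.Any as Any
open import Data.List.Relation.Unary.Any using (here; there; index)
open import Data.List.Relation.Unary.Unique.Propositional using (Unique; []; _∷_)
open import Data.List.Relation.Unary.Unique.Propositional.Properties using (filter⁺; cartesianProduct⁺; allFin⁺; upTo⁺)
open import Data.Nat as ℕ using (ℕ; zero; suc; _∸_; z≤n; s≤s)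
open import Data.Nat.Divisibility using (_∣_; quotient; m∣m*n; ∣n⇒∣m*n; m∣n⇒n≡quotient*m)
import Data.Nat.Properties as ℕ
open import Data.Product using (_,_; proj₁; proj₂)
open import Data.Product.Properties using (≡-dec)
open import Data.Rational as ℚ using (ℚ; 0ℚ; 1ℚ; _+_; _*_; _-_; -_; _<_; toℚᵘ)
open import Data.Rational.Literals using (fromℤ)
open import Data.Rational.Properties hiding (_≟_)
open import Data.Rational.Solver using (module +-*-Solver)
import Data.Rational.Unnormalised as ℚᵘ
import Data.Rational.Unnormalised.Properties as ℚᵘ
import Data.Sum as Sum
open import Data.Sum using (_⊎_; inj₁; inj₂; [_,_])
open import Function using (_∘_)
open import Relation.Binary.Definitions using (DecidableEquality)
open import Relation.Binary.PropositionalEquality using (refl; sym; trans; cong; cong₂; subst; _≢_; module ≡-Reasoning)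
open import Relation.Nullary using (Dec; yes; no; ¬_)
open import Relation.Nullary.Decidable using (_×-dec_; _⊎-dec_; ¬?; map′)

open import Algebra.Properties.Semiring.Sum (Ring.semiring +-*-ring) using (sum; sum-syntax; sum-cong-≗; sum-replicate-zero; ∑-distrib-+; ∑-comm; *-distribˡ-sum)
open import Data.List.Membership.DecPropositional ℕ._≟_ using () renaming (_∈?_ to _∈ℕ?_)
open +-*-Solver

χ : ∀ {p} {P : Set p} → Dec P → ℚ
χ (yes _) = 1ℚ
χ (no _)  = 0ℚ

module _ {p} {P : Set p} where

  χ-nonneg : (d : Dec P) → 0ℚ ≤ χ d
  χ-nonneg (yes _) = nonNegative⁻¹ 1ℚ
  χ-nonneg (no _)  = ≤-refl

  χ-yes : (d : Dec P) → P → χ d ≡ 1ℚ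
  χ-yes (yes _) _  = refl
  χ-yes (no ¬p) p = ⊥-elim (¬p p)

  χ-no : (d : Dec P) → ¬ P → χ d ≡ 0ℚ
  χ-no (yes p) ¬p = ⊥-elim (¬p p)
  χ-no (no _)  _  = refl

χ-cong : ∀ {p q} {P : Set p} {Q : Set q} (d : Dec P) (d′ : Dec Q) → (P → Q) → (Q → P) → χ d ≡ χ d′
χ-cong (yes p) d′ P→Q _ = sym (χ-yes d′ (P→Q p))
χ-cong (no ¬p) d′ _ Q→P = sym (χ-no d′ (¬p ∘ Q→P))

module _ {p q r} {P : Set p} {Q : Set q} {R : Set r} where

  χ-× : (d : Dec P) (d₁ : Dec Q) (d₂ : Dec R) → (P → Q × R) → (Q → R → P) → χ d ≡ χ d₁ * χ d₂
  χ-× d (yes q) (yes r) _ QR→P rewrite χ-yes d (QR→P q r) = refl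
  χ-× d (yes q) (no ¬r) P→QR _ rewrite χ-no d (¬r ∘ proj₂ ∘ P→QR) = sym (*-zeroʳ 1ℚ)
  χ-× d (no ¬q) d₂ P→QR _ rewrite χ-no d (¬q ∘ proj₁ ∘ P→QR) = sym (*-zeroˡ (χ d₂))

  χ-⊎ : (d : Dec P) (d₁ : Dec Q) (d₂ : Dec R) → (P → Q ⊎ R) → (Q → P) → (R → P) → (Q → ¬ R) →
        χ d ≡ χ d₁ + χ d₂
  χ-⊎ d (yes q) d₂ _ Q→P _ Q→¬R rewrite χ-yes d (Q→P q) | χ-no d₂ (Q→¬R q) = sym (+-identityʳ 1ℚ)
  χ-⊎ d (no ¬q) (yes r) _ _ R→P _ rewrite χ-yes d (R→P r) = sym (+-identityˡ 1ℚ)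
  χ-⊎ d (no ¬q) (no ¬r) P→Q⊎R _ _ _ = χ-no d λ p → [ ¬q , ¬r ] (P→Q⊎R p)

χ-mono : ∀ {p q} {P : Set p} {Q : Set q} (d : Dec P) (d′ : Dec Q) → (P → Q) → χ d ≤ χ d′
χ-mono (yes p) d′ P→Q = ≤-reflexive (sym (χ-yes d′ (P→Q p)))
χ-mono (no _)  d′ _   = χ-nonneg d′

*-nonneg : ∀ {p q} → 0ℚ ≤ p → 0ℚ ≤ q → 0ℚ ≤ p * q
*-nonneg {p} {q} 0≤p 0≤q = nonNegative⁻¹ _ {{nonNeg*nonNeg⇒nonNeg p {{ℚ.nonNegative 0≤p}} q {{ℚ.nonNegative 0≤q}}}}

*-nonpos : ∀ {p q} → 0ℚ ≤ p → q ≤ 0ℚ → p * q ≤ 0ℚ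
*-nonpos {p} 0≤p q≤0 = subst (p * _ ≤_) (*-zeroʳ p) (*-monoˡ-≤-nonNeg p {{ℚ.nonNegative 0≤p}} q≤0)

p≤q⇒0≤q-p : ∀ {p q} → p ≤ q → 0ℚ ≤ q - p
p≤q⇒0≤q-p {p} {q} p≤q = subst (_≤ q - p) (+-inverseʳ p) (+-monoˡ-≤ (- p) p≤q)

p-q≤p : ∀ {p q} → 0ℚ ≤ q → p - q ≤ p
p-q≤p {p} {q} 0≤q = subst (p - q ≤_) (+-identityʳ p) (+-monoʳ-≤ p (neg-antimono-≤ 0≤q))

ΣFin≡sum : ∀ k (g : Fin k → ℚ) → ΣFin k g ≡ sum g
ΣFin≡sum zero    g = refl
ΣFin≡sum (suc k) g = cong (g zero +_) (ΣFin≡sum k (g ∘ suc))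

sum-mono-≤ : ∀ {k} {f g : Fin k → ℚ} → (∀ i → f i ≤ g i) → sum f ≤ sum g
sum-mono-≤ {zero}  f≤g = ≤-refl
sum-mono-≤ {suc k} f≤g = +-mono-≤ (f≤g zero) (sum-mono-≤ (f≤g ∘ suc))

sum-zero : ∀ {k} {f : Fin k → ℚ} → (∀ i → f i ≡ 0ℚ) → sum f ≡ 0ℚ
sum-zero {k} f≡0 = trans (sum-cong-≗ f≡0) (sum-replicate-zero k)

sum-nonneg : ∀ {k} {f : Fin k → ℚ} → (∀ i → 0ℚ ≤ f i) → 0ℚ ≤ sum f
sum-nonneg {k} {f} 0≤f = subst (_≤ sum f) (sum-replicate-zero k) (sum-mono-≤ 0≤f)

sum-single : ∀ {k} (f : Fin k → ℚ) j → (∀ i → i ≢ j → f i ≡ 0ℚ) → sum f ≡ f j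
sum-single f zero    off = trans (cong (f zero +_) (sum-zero (λ i → off (suc i) λ ()))) (+-identityʳ _)
sum-single f (suc j) off = trans (cong₂ _+_ (off zero λ ()) (sum-single (f ∘ suc) j (λ i i≢j → off (suc i) (i≢j ∘ Fin.suc-injective))))
                                 (+-identityˡ _)

∑-distrib-- : ∀ {k} (f g : Fin k → ℚ) → sum (λ i → f i - g i) ≡ sum f - sum g
∑-distrib-- {zero}  f g = refl
∑-distrib-- {suc k} f g = trans (cong (f zero - g zero +_) (∑-distrib-- (f ∘ suc) (g ∘ suc)))
  (solve 4 (λ a b c d → (a :- b) :+ (c :- d) := (a :+ c) :- (b :+ d)) refl (f zero) (g zero) (sum (f ∘ suc)) (sum (g ∘ suc)))

telescope : ∀ T (Q : ℕ → ℚ) → Q T ≡ Q 0 + ∑[ l < T ] (Q (suc (toℕ l)) - Q (toℕ l))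
telescope zero    Q = sym (+-identityʳ (Q 0))
telescope (suc T) Q = trans (telescope T (Q ∘ suc))
  (solve 3 (λ q₀ q₁ σ → q₁ :+ σ := q₀ :+ ((q₁ :- q₀) :+ σ)) refl (Q 0) (Q 1) (∑[ l < T ] (Q (suc (suc (toℕ l))) - Q (suc (toℕ l)))))

module _ {A : Set} where

  private
    ∈-─ : ∀ {x : A} {xs} (x∈xs : x ∈ xs) {z} → z ∈ xs → z ≢ x → z ∈ xs ─ x∈xs
    ∈-─ (here refl)  (here refl)  z≢x = ⊥-elim (z≢x refl)
    ∈-─ (here refl)  (there z∈xs) _   = z∈xs
    ∈-─ (there x∈xs) (here refl)  _   = here refl
    ∈-─ (there x∈xs) (there z∈xs) z≢x = there (∈-─ x∈xs z∈xs z≢x)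

  unique-⊆⇒length≤ : ∀ {xs ys : List A} → Unique xs → (∀ {z} → z ∈ xs → z ∈ ys) → length xs ℕ.≤ length ys
  unique-⊆⇒length≤ {[]}     _                  _     = z≤n
  unique-⊆⇒length≤ {x ∷ xs} {ys} (x∉xs ∷ unique) xs⊆ys = begin
    suc (length xs)                              ≤⟨ s≤s (unique-⊆⇒length≤ unique λ z∈xs →
                                                     ∈-─ x∈ys (xs⊆ys (there z∈xs)) λ { refl → All.lookup x∉xs z∈xs refl }) ⟩
    suc (length (ys ─ x∈ys))                     ≡⟨ sym (length-removeAt′ ys (index x∈ys)) ⟩
    length ys                                    ∎
    where
    open ℕ.≤-Reasoning
    x∈ys = xs⊆ys (here refl)

-- Integer multiples of a unit

fromℤ-+ : ∀ a b → fromℤ (a ℤ.+ b) ≡ fromℤ a + fromℤ b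
fromℤ-+ a b = toℚᵘ-injective (ℚᵘ.≃-trans (ℚᵘ.*≡* integral) (ℚᵘ.≃-sym (toℚᵘ-homo-+ (fromℤ a) (fromℤ b))))
  where
  integral : (a ℤ.+ b) ℤ.* ℤ.+ 1 ≡ (a ℤ.* ℤ.+ 1 ℤ.+ b ℤ.* ℤ.+ 1) ℤ.* ℤ.+ 1
  integral rewrite ℤ.*-identityʳ a | ℤ.*-identityʳ b = refl

fromℤ-neg : ∀ a → fromℤ (ℤ.- a) ≡ - fromℤ a
fromℤ-neg a = toℚᵘ-injective (ℚᵘ.≃-sym (toℚᵘ-homo‿- (fromℤ a)))

fromℤ-mono-≤ : ∀ {a b} → a ℤ.≤ b → fromℤ a ≤ fromℤ b
fromℤ-mono-≤ a≤b = toℚᵘ-cancel-≤ (ℚᵘ.*≤* (ℤ.*-monoʳ-≤-nonNeg (ℤ.+ 1) a≤b))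

fromℤ-mono-< : ∀ {a b} → a ℤ.< b → fromℤ a < fromℤ b
fromℤ-mono-< a<b = toℚᵘ-cancel-< (ℚᵘ.*<* (ℤ.*-monoʳ-<-pos (ℤ.+ 1) a<b))

record IntMultiple (u q : ℚ) : Set where
  constructor multiple
  field
    coefficient  : ℤ
    is-multiple  : q ≡ fromℤ coefficient * u

module _ {u : ℚ} where

  multiple-0 : IntMultiple u 0ℚ
  multiple-0 = multiple (ℤ.+ 0) (sym (*-zeroˡ u))

  multiple-self : IntMultiple u u
  multiple-self = multiple (ℤ.+ 1) (sym (*-identityˡ u))

  multiple-+ : ∀ {p q} → IntMultiple u p → IntMultiple u q → IntMultiple u (p + q)
  multiple-+ (multiple a refl) (multiple b refl) = multiple (a ℤ.+ b) (trans (sym (*-distribʳ-+ u (fromℤ a) (fromℤ b))) (cong (_* u) (sym (fromℤ-+ a b))))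

  multiple-neg : ∀ {p} → IntMultiple u p → IntMultiple u (- p)
  multiple-neg (multiple a refl) = multiple (ℤ.- a) (trans (neg-distribˡ-* (fromℤ a) u) (cong (_* u) (sym (fromℤ-neg a))))

  multiple-- : ∀ {p q} → IntMultiple u p → IntMultiple u q → IntMultiple u (p - q)
  multiple-- p∈ q∈ = multiple-+ p∈ (multiple-neg q∈)

  multiple-χ* : ∀ {p} {P : Set p} (d : Dec P) {q} → IntMultiple u q → IntMultiple u (χ d * q)
  multiple-χ* (yes _) {q} q∈ = subst (IntMultiple u) (sym (*-identityˡ q)) q∈
  multiple-χ* (no _)  {q} _  = subst (IntMultiple u) (sym (*-zeroˡ q)) multiple-0

  multiple-sum : ∀ {k} {g : Fin k → ℚ} → (∀ i → IntMultiple u (g i)) → IntMultiple u (sum g)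
  multiple-sum {zero}  g∈ = multiple-0
  multiple-sum {suc k} g∈ = multiple-+ (g∈ zero) (multiple-sum (g∈ ∘ suc))

  multiple<unit⇒0 : 0ℚ < u → ∀ {q} → IntMultiple u q → 0ℚ ≤ q → q < u → q ≡ 0ℚ
  multiple<unit⇒0 0<u (multiple z refl) 0≤q q<u with z ℤ.≤? ℤ.+ 0
  ... | yes z≤0 = ≤-antisym (subst (fromℤ z * u ≤_) (*-zeroˡ u) (*-monoʳ-≤-nonNeg u {{ℚ.nonNegative (<⇒≤ 0<u)}} (fromℤ-mono-≤ z≤0))) 0≤q
  ... | no z≰0  = ⊥-elim (<-irrefl refl (<-≤-trans q<u (subst (_≤ fromℤ z * u) (*-identityˡ u)
                    (*-monoʳ-≤-nonNeg u {{ℚ.nonNegative (<⇒≤ 0<u)}} (fromℤ-mono-≤ (ℤ.i<j⇒suc[i]≤j (ℤ.≰⇒> z≰0)))))))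

private
  -- suc (pred-∏suc g) is the product of the numbers suc (g i).
  pred-∏suc : ∀ {k} → (Fin k → ℕ) → ℕ
  pred-∏suc {zero}  g = 0
  pred-∏suc {suc k} g = pred-∏suc (g ∘ suc) ℕ.+ g zero ℕ.* suc (pred-∏suc (g ∘ suc))

  suc-∣-∏suc : ∀ {k} (g : Fin k → ℕ) i → suc (g i) ∣ suc (pred-∏suc g)
  suc-∣-∏suc g zero    = m∣m*n (suc (pred-∏suc (g ∘ suc)))
  suc-∣-∏suc g (suc i) = ∣n⇒∣m*n (suc (g zero)) (suc-∣-∏suc (g ∘ suc) i)

  unit-multiple : ∀ p R D′ → R ℕ.* ℚ.↧ₙ p ≡ suc D′ →
                  p ≡ fromℤ (ℚ.↥ p ℤ.* ℤ.+ R) * ℚ.fromℚᵘ (ℚᵘ.mkℚᵘ (ℤ.+ 1) D′)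
  unit-multiple p@(ℚ.mkℚ n d _) R D′ R*d≡D = toℚᵘ-injective (begin
    toℚᵘ p                                  ≈⟨ ℚᵘ.*≡* cross ⟩
    ℚᵘ.mkℚᵘ z 0 ℚᵘ.* ℚᵘ.mkℚᵘ (ℤ.+ 1) D′      ≈⟨ ℚᵘ.*-congˡ {ℚᵘ.mkℚᵘ z 0} (ℚᵘ.≃-sym (toℚᵘ-fromℚᵘ (ℚᵘ.mkℚᵘ (ℤ.+ 1) D′))) ⟩
    toℚᵘ (fromℤ z) ℚᵘ.* toℚᵘ u               ≈⟨ ℚᵘ.≃-sym (toℚᵘ-homo-* (fromℤ z) u) ⟩
    toℚᵘ (fromℤ z * u)                      ∎)
    where
    open ℚᵘ.≃-Reasoning
    u = ℚ.fromℚᵘ (ℚᵘ.mkℚᵘ (ℤ.+ 1) D′)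
    z = n ℤ.* ℤ.+ R
    cross : n ℤ.* ℤ.+ (1 ℕ.* suc D′) ≡ z ℤ.* ℤ.+ 1 ℤ.* ℤ.+ suc d
    cross = trans (cong (λ k → n ℤ.* ℤ.+ k) (trans (ℕ.*-identityˡ (suc D′)) (sym R*d≡D)))
           (trans (cong (n ℤ.*_) (ℤ.pos-* R (suc d)))
           (trans (sym (ℤ.*-assoc n (ℤ.+ R) (ℤ.+ suc d)))
                  (cong (ℤ._* ℤ.+ suc d) (sym (ℤ.*-identityʳ z)))))

commonUnit : ∀ {k} (c : Fin k → ℚ) → Σ ℚ λ u → 0ℚ < u × (∀ i → IntMultiple u (c i))
commonUnit c = u , 0<u , multiple-of-u
  where
  D′ : ℕ
  D′ = pred-∏suc (ℚ.denominator-1 ∘ c)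
  u : ℚ
  u = ℚ.fromℚᵘ (ℚᵘ.mkℚᵘ (ℤ.+ 1) D′)
  0<u : 0ℚ < u
  0<u = toℚᵘ-cancel-< (ℚᵘ.<-respʳ-≃ (ℚᵘ.≃-sym (toℚᵘ-fromℚᵘ (ℚᵘ.mkℚᵘ (ℤ.+ 1) D′))) (ℚᵘ.*<* (ℤ.+<+ (s≤s z≤n))))
  multiple-of-u : ∀ i → IntMultiple u (c i)
  multiple-of-u i = multiple _ (unit-multiple (c i) (quotient D-divisible) D′ (sym (m∣n⇒n≡quotient*m D-divisible)))
    where D-divisible = suc-∣-∏suc (ℚ.denominator-1 ∘ c) i

module _ (N : TemporalNetwork) where
  open TemporalNetwork N

  private
    record Bounded (k : ℕ) (g : Fin k → ℕ) (x : ℕ) : Set where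
      constructor bounded
      field bound : ∀ i → g i ℕ.≤ x

    maxLabel : Fin m → ℕ
    maxLabel e = foldr ℕ._⊔_ 0 (L e)

  -- lmax is computed by a helper local to Defs; abstracting over m lets Agda recurse on it.
  mutual
    private
      maxLabel≤lmax : Bounded m maxLabel (lmax N)
      maxLabel≤lmax with m | maxLabel
      ... | k | g = maximum-bounded k g

      maximum-bounded : (k : ℕ) (g : Fin k → ℕ) → Bounded k g _
      maximum-bounded zero    g = bounded λ ()
      maximum-bounded (suc k) g with bounded g∘suc≤ ← maximum-bounded k (g ∘ suc) =
        bounded λ { zero → ℕ.m≤m⊔n _ _ ; (suc i) → ℕ.≤-trans (g∘suc≤ i) (ℕ.m≤n⊔m _ _) }

  label≤lmax : ∀ {e l} → l ∈ L e → l ℕ.≤ lmax N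
  label≤lmax {e} l∈ = ℕ.≤-trans (foldr-⊔-upper (L e) l∈) (Bounded.bound maxLabel≤lmax e)
    where
    foldr-⊔-upper : ∀ xs {x} → x ∈ xs → x ℕ.≤ foldr ℕ._⊔_ 0 xs
    foldr-⊔-upper (y ∷ ys) (here refl) = ℕ.m≤m⊔n y _
    foldr-⊔-upper (y ∷ ys) (there x∈) = ℕ.≤-trans (foldr-⊔-upper ys x∈) (ℕ.m≤n⊔m y _)

  flowAt : (Fin m → Fin n) → (Fin m → ℕ → ℚ) → Fin n → ℕ → ℚ
  flowAt end f v l = ∑[ e < m ] (χ (end e ≟ v) * f e l)

  In Out : (Fin m → ℕ → ℚ) → Fin n → ℕ → ℚ
  In  = flowAt tgt
  Out = flowAt src

  -- The summands of inflow and outflow are local to Defs; the mutual block lets unification name them.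
  mutual
    inflow≡In : ∀ f v l → inflow N f v l ≡ In f v l
    inflow≡In f v l = trans (ΣFin≡sum m _) (sum-cong-≗ (inflow-summand f v l))

    private
      inflow-summand : ∀ f v l e → _ ≡ χ (tgt e ≟ v) * f e l
      inflow-summand f v l e with tgt e ≟ v
      ... | yes _ = sym (*-identityˡ (f e l))
      ... | no _  = sym (*-zeroˡ (f e l))

  mutual
    outflow≡Out : ∀ f v l → outflow N f v l ≡ Out f v l
    outflow≡Out f v l = trans (ΣFin≡sum m _) (sum-cong-≗ (outflow-summand f v l))

    private
      outflow-summand : ∀ f v l e → _ ≡ χ (src e ≟ v) * f e l
      outflow-summand f v l e with src e ≟ v
      ... | yes _ = sym (*-identityˡ (f e l))
      ... | no _  = sym (*-zeroˡ (f e l))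

  In-nonneg : ∀ {f} → (∀ e l → 0ℚ ≤ f e l) → ∀ v l → 0ℚ ≤ In f v l
  In-nonneg f≥0 v l = sum-nonneg λ e → *-nonneg (χ-nonneg (tgt e ≟ v)) (f≥0 e l)

  B⁺ Bμ : (Fin m → ℕ → ℚ) → Fin n → ℕ → ℚ
  B⁺ f v zero    = 0ℚ
  B⁺ f v (suc l) = B⁺ f v l - Out f v (suc l) + In f v (suc l)
  Bμ f v zero    = 0ℚ
  Bμ f v (suc l) = B⁺ f v l - Out f v (suc l)

  record Feasible (f : Fin m → ℕ → ℚ) : Set where
    field
      nonneg     : ∀ e l → 0ℚ ≤ f e l
      ≤cap       : ∀ e l → f e l ≤ c e
      off-labels : ∀ e l → l ≡ 0 ⊎ l ∉ L e → f e l ≡ 0ℚ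
      Bμ-nonneg  : ∀ v → v ≢ s → ∀ l → 0ℚ ≤ Bμ f v (suc l)

  temporalFlow : ∀ {f} → Feasible f → TemporalFlow N
  temporalFlow {f} feasible = record
    { f        = f
    ; b⁻       = B⁻
    ; bμ       = Bμ f
    ; b⁺       = B⁺ f
    ; f-nonneg = nonneg
    ; f-cap    = ≤cap
    ; f-zero   = off-labels
    ; b-init   = λ _ _ → refl , refl , refl
    ; b-step   = λ v _ l → refl
                         , cong (λ o → B⁺ f v l - o) (sym (outflow≡Out f v (suc l)))
                         , cong (Bμ f v (suc l) +_) (sym (inflow≡In f v (suc l)))
    ; b-nonneg = λ v v≢s l _ → B⁻-nonneg v v≢s l , Bμ-nonneg′ v v≢s l , B⁺-nonneg v v≢s l
    }
    where
    open Feasible feasible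
    B⁻ : Fin n → ℕ → ℚ
    B⁻ v zero    = 0ℚ
    B⁻ v (suc l) = B⁺ f v l
    Bμ-nonneg′ : ∀ v → v ≢ s → ∀ l → 0ℚ ≤ Bμ f v l
    Bμ-nonneg′ v v≢s zero    = ≤-refl
    Bμ-nonneg′ v v≢s (suc l) = Bμ-nonneg v v≢s l
    B⁺-nonneg : ∀ v → v ≢ s → ∀ l → 0ℚ ≤ B⁺ f v l
    B⁺-nonneg v v≢s zero    = ≤-refl
    B⁺-nonneg v v≢s (suc l) = +-mono-≤ (Bμ-nonneg v v≢s l) (In-nonneg nonneg v (suc l))
    B⁻-nonneg : ∀ v → v ≢ s → ∀ l → 0ℚ ≤ B⁻ v l
    B⁻-nonneg v v≢s zero    = ≤-refl
    B⁻-nonneg v v≢s (suc l) = B⁺-nonneg v v≢s l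

  -- The potential identity

  ∑-by-endpoint : ∀ (w : Fin n → ℚ) (g : Fin m → ℚ) (h : Fin m → Fin n) →
            ∑[ v < n ] (w v * ∑[ e < m ] (χ (h e ≟ v) * g e)) ≡ ∑[ e < m ] (g e * w (h e))
  ∑-by-endpoint w g h = begin
    ∑[ v < n ] (w v * ∑[ e < m ] (χ (h e ≟ v) * g e))  ≡⟨ sum-cong-≗ (λ v → *-distribˡ-sum (w v) (λ e → χ (h e ≟ v) * g e)) ⟩
    ∑[ v < n ] ∑[ e < m ] (w v * (χ (h e ≟ v) * g e))  ≡⟨ ∑-comm (λ v e → w v * (χ (h e ≟ v) * g e)) ⟩
    ∑[ e < m ] ∑[ v < n ] (w v * (χ (h e ≟ v) * g e))  ≡⟨ sum-cong-≗ (λ e → sum-single (λ v → w v * (χ (h e ≟ v) * g e)) (h e) (off e)) ⟩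
    ∑[ e < m ] (w (h e) * (χ (h e ≟ h e) * g e))       ≡⟨ sum-cong-≗ on ⟩
    ∑[ e < m ] (g e * w (h e))                         ∎
    where
    open ≡-Reasoning
    off : ∀ e v → v ≢ h e → w v * (χ (h e ≟ v) * g e) ≡ 0ℚ
    off e v v≢he rewrite χ-no (h e ≟ v) (v≢he ∘ sym) | *-zeroˡ (g e) = *-zeroʳ (w v)
    on : ∀ e → w (h e) * (χ (h e ≟ h e) * g e) ≡ g e * w (h e)
    on e rewrite χ-yes (h e ≟ h e) refl | *-identityˡ (g e) = *-comm (w (h e)) (g e)

  module Potential (F : TemporalFlow N) (a : Fin n → ℕ → ℚ) where
    open TemporalFlow F

    Φ : ℕ → ℚ
    Φ l = ∑[ v < n ] (a v l * b⁺ v l)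

    edgeGain bufferLoss : ℕ → ℚ
    edgeGain l   = ∑[ e < m ] (f e (suc l) * (a (tgt e) (suc l) - a (src e) l))
    bufferLoss l = ∑[ v < n ] ((a v l - a v (suc l)) * bμ v (suc l))

    private
      Φ-step-at : ∀ l → a s l ≡ 0ℚ → a s (suc l) ≡ 0ℚ → ∀ v →
                  a v (suc l) * b⁺ v (suc l) - a v l * b⁺ v l
                  ≡ (a v (suc l) * In f v (suc l) - a v l * Out f v (suc l)) - (a v l - a v (suc l)) * bμ v (suc l)
      Φ-step-at l as≡0 as′≡0 v with v ≟ s
      ... | yes refl rewrite as≡0 | as′≡0 =
        solve 5 (λ b b′ i o μ → con 0ℚ :* b′ :- con 0ℚ :* b := (con 0ℚ :* i :- con 0ℚ :* o) :- (con 0ℚ :- con 0ℚ) :* μ)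
          refl (b⁺ s l) (b⁺ s (suc l)) (In f s (suc l)) (Out f s (suc l)) (bμ s (suc l))
      ... | no v≢s with b-step v v≢s l
      ... | _ , bμ≡ , b⁺≡ rewrite b⁺≡ | bμ≡ | proj₁ (b-step v v≢s l) | inflow≡In f v (suc l) | outflow≡Out f v (suc l) =
        solve 5 (λ α α′ b i o → α′ :* ((b :- o) :+ i) :- α :* b := (α′ :* i :- α :* o) :- (α :- α′) :* (b :- o))
          refl (a v l) (a v (suc l)) (b⁺ v l) (In f v (suc l)) (Out f v (suc l))

    Φ-step : ∀ l → a s l ≡ 0ℚ → a s (suc l) ≡ 0ℚ → Φ (suc l) - Φ l ≡ edgeGain l - bufferLoss l
    Φ-step l as≡0 as′≡0 = begin
      Φ (suc l) - Φ l
        ≡⟨ sym (∑-distrib-- (λ v → a v (suc l) * b⁺ v (suc l)) (λ v → a v l * b⁺ v l)) ⟩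
      ∑[ v < n ] (a v (suc l) * b⁺ v (suc l) - a v l * b⁺ v l)
        ≡⟨ sum-cong-≗ (Φ-step-at l as≡0 as′≡0) ⟩
      ∑[ v < n ] ((a v (suc l) * In f v (suc l) - a v l * Out f v (suc l)) - (a v l - a v (suc l)) * bμ v (suc l))
        ≡⟨ trans (∑-distrib-- (λ v → a v (suc l) * In f v (suc l) - a v l * Out f v (suc l)) (λ v → (a v l - a v (suc l)) * bμ v (suc l)))
                 (cong (_- bufferLoss l) (∑-distrib-- (λ v → a v (suc l) * In f v (suc l)) (λ v → a v l * Out f v (suc l)))) ⟩
      ∑[ v < n ] (a v (suc l) * In f v (suc l)) - ∑[ v < n ] (a v l * Out f v (suc l)) - bufferLoss l
        ≡⟨ cong₂ (λ x y → x - y - bufferLoss l) (∑-by-endpoint (λ v → a v (suc l)) (λ e → f e (suc l)) tgt)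
                                                 (∑-by-endpoint (λ v → a v l) (λ e → f e (suc l)) src) ⟩
      ∑[ e < m ] (f e (suc l) * a (tgt e) (suc l)) - ∑[ e < m ] (f e (suc l) * a (src e) l) - bufferLoss l
        ≡⟨ cong (_- bufferLoss l) (sym (trans (sum-cong-≗ λ e → *-distribˡ-minus (f e (suc l)) _ _)
                                              (∑-distrib-- (λ e → f e (suc l) * a (tgt e) (suc l)) (λ e → f e (suc l) * a (src e) l)))) ⟩
      edgeGain l - bufferLoss l
        ∎
      where
      open ≡-Reasoning
      *-distribˡ-minus : ∀ x y z → x * (y - z) ≡ x * y - x * z
      *-distribˡ-minus = solve 3 (λ x y z → x :* (y :- z) := x :* y :- x :* z) refl

    value≡∑gain : (∀ l → l ℕ.≤ lmax N → a s l ≡ 0ℚ) → a t (lmax N) ≡ 1ℚ →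
                  (∀ v → v ≢ t → a v (lmax N) * b⁺ v (lmax N) ≡ 0ℚ) →
                  value N F ≡ ∑[ l < lmax N ] (edgeGain (toℕ l) - bufferLoss (toℕ l))
    value≡∑gain as≡0 at≡1 others≡0 = begin
      b⁺ t T                                                       ≡⟨ sym (trans (sum-single _ t others≡0) t-term) ⟩
      Φ T                                                          ≡⟨ telescope T Φ ⟩
      Φ 0 + ∑[ l < T ] (Φ (suc (toℕ l)) - Φ (toℕ l))               ≡⟨ cong₂ _+_ Φ-init (sum-cong-≗ steps) ⟩
      0ℚ + ∑[ l < T ] (edgeGain (toℕ l) - bufferLoss (toℕ l))      ≡⟨ +-identityˡ _ ⟩
      ∑[ l < T ] (edgeGain (toℕ l) - bufferLoss (toℕ l))           ∎
      where
      open ≡-Reasoning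
      T = lmax N
      t-term : a t T * b⁺ t T ≡ b⁺ t T
      t-term rewrite at≡1 = *-identityˡ (b⁺ t T)
      Φ-init : Φ 0 ≡ 0ℚ
      Φ-init = sum-zero init-at
        where
        init-at : ∀ v → a v 0 * b⁺ v 0 ≡ 0ℚ
        init-at v with v ≟ s
        ... | yes refl rewrite as≡0 0 z≤n = *-zeroˡ (b⁺ s 0)
        ... | no v≢s rewrite proj₂ (proj₂ (b-init v v≢s)) = *-zeroʳ (a v 0)
      steps : ∀ (l : Fin T) → Φ (suc (toℕ l)) - Φ (toℕ l) ≡ edgeGain (toℕ l) - bufferLoss (toℕ l)
      steps l = Φ-step (toℕ l) (as≡0 _ (ℕ.<⇒≤ (Fin.toℕ<n l))) (as≡0 _ (Fin.toℕ<n l))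

  -- Capacity of a cut, time step by time step

  _≟ᵗ_ : DecidableEquality (TimeEdge N)
  _≟ᵗ_ = ≡-dec _≟_ ℕ._≟_

  open import Data.List.Membership.DecPropositional _≟ᵗ_ using () renaming (_∈?_ to _∈ᵗ?_)

  label-pred<lmax : ∀ {e l} → l ∈ L e → Σ ℕ λ j → l ≡ suc j × j ℕ.< lmax N
  label-pred<lmax {e} {zero}  l∈ = ⊥-elim (ℕ.<-irrefl refl (All.lookup (L-pos e) l∈))
  label-pred<lmax {e} {suc j} l∈ = j , refl , label≤lmax l∈

  capacityAt : List (TimeEdge N) → ℕ → ℚ
  capacityAt S l = ∑[ e < m ] (χ ((e , suc l) ∈ᵗ? S) * c e)

  ∑capacityAt-single : ∀ {x} → IsTimeEdge N x →
                       ∑[ l < lmax N ] ∑[ e < m ] (χ ((e , suc (toℕ l)) ≟ᵗ x) * c e) ≡ c (proj₁ x)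
  ∑capacityAt-single {e₀ , _} l∈ with label-pred<lmax l∈
  ... | j , refl , j<T = begin
    ∑[ l < T ] ∑[ e < m ] (χ ((e , suc (toℕ l)) ≟ᵗ (e₀ , suc j)) * c e)  ≡⟨ sum-cong-≗ (λ l → sum-single _ e₀ (other-edge l)) ⟩
    ∑[ l < T ] (χ ((e₀ , suc (toℕ l)) ≟ᵗ (e₀ , suc j)) * c e₀)          ≡⟨ sum-single _ (fromℕ< j<T) other-time ⟩
    χ ((e₀ , suc (toℕ (fromℕ< j<T))) ≟ᵗ (e₀ , suc j)) * c e₀           ≡⟨ cong (_* c e₀) (χ-yes (_ ≟ᵗ _) (cong (λ i → e₀ , suc i) (Fin.toℕ-fromℕ< j<T))) ⟩
    1ℚ * c e₀                                                           ≡⟨ *-identityˡ (c e₀) ⟩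
    c e₀                                                                ∎
    where
    open ≡-Reasoning
    T = lmax N
    other-edge : ∀ (l : Fin T) e → e ≢ e₀ → χ ((e , suc (toℕ l)) ≟ᵗ (e₀ , suc j)) * c e ≡ 0ℚ
    other-edge l e e≢e₀ rewrite χ-no ((e , suc (toℕ l)) ≟ᵗ (e₀ , suc j)) (e≢e₀ ∘ cong proj₁) = *-zeroˡ (c e)
    other-time : ∀ l → l ≢ fromℕ< j<T → χ ((e₀ , suc (toℕ l)) ≟ᵗ (e₀ , suc j)) * c e₀ ≡ 0ℚ
    other-time l l≢j rewrite χ-no ((e₀ , suc (toℕ l)) ≟ᵗ (e₀ , suc j)) (λ eq → l≢j (Fin.toℕ-injective
      (trans (ℕ.suc-injective (cong proj₂ eq)) (sym (Fin.toℕ-fromℕ< j<T))))) = *-zeroˡ (c e₀)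

  capacity≡∑capacityAt : ∀ {S} → TimeEdgeSet N S → capacity N S ≡ ∑[ l < lmax N ] capacityAt S (toℕ l)
  capacity≡∑capacityAt {[]}    _ = sym (sum-zero {lmax N} λ l → sum-zero λ e → *-zeroˡ (c e))
  capacity≡∑capacityAt {x ∷ S} (x∉S ∷ unique , x∈L ∷ S∈L) = begin
    c (proj₁ x) + capacity N S
      ≡⟨ cong₂ _+_ (sym (∑capacityAt-single x∈L)) (capacity≡∑capacityAt (unique , S∈L)) ⟩
    ∑[ l < T ] ∑[ e < m ] (χ ((e , suc (toℕ l)) ≟ᵗ x) * c e) + ∑[ l < T ] capacityAt S (toℕ l)
      ≡⟨ sym (∑-distrib-+ {T} (λ l → ∑[ e < m ] (χ ((e , suc (toℕ l)) ≟ᵗ x) * c e)) (λ l → capacityAt S (toℕ l))) ⟩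
    ∑[ l < T ] (∑[ e < m ] (χ ((e , suc (toℕ l)) ≟ᵗ x) * c e) + capacityAt S (toℕ l))
      ≡⟨ sum-cong-≗ {T} (λ l → sym (trans (sum-cong-≗ (split (toℕ l)))
                                   (∑-distrib-+ (λ e → χ ((e , suc (toℕ l)) ≟ᵗ x) * c e) (λ e → χ ((e , suc (toℕ l)) ∈ᵗ? S) * c e)))) ⟩
    ∑[ l < T ] capacityAt (x ∷ S) (toℕ l)
      ∎
    where
    open ≡-Reasoning
    T = lmax N
    split : ∀ l e → χ ((e , suc l) ∈ᵗ? x ∷ S) * c e ≡ χ ((e , suc l) ≟ᵗ x) * c e + χ ((e , suc l) ∈ᵗ? S) * c e
    split l e = trans (cong (_* c e) (χ-⊎ ((e , suc l) ∈ᵗ? x ∷ S) ((e , suc l) ≟ᵗ x) ((e , suc l) ∈ᵗ? S)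
                                          ∈-∷⁻ here there (λ { refl → All¬⇒¬Any x∉S })))
                      (*-distribʳ-+ (c e) (χ ((e , suc l) ≟ᵗ x)) (χ ((e , suc l) ∈ᵗ? S)))
      where
      ∈-∷⁻ : ∀ {y} → y ∈ x ∷ S → y ≡ x ⊎ y ∈ S
      ∈-∷⁻ (here y≡x)  = inj₁ y≡x
      ∈-∷⁻ (there y∈S) = inj₂ y∈S

  capacityAt-mono-⊆ : ∀ {S S′} → (∀ {x} → x ∈ S → x ∈ S′) → ∀ l → capacityAt S l ≤ capacityAt S′ l
  capacityAt-mono-⊆ {S} {S′} S⊆S′ l = sum-mono-≤ {m} λ e →
    *-monoʳ-≤-nonNeg (c e) {{ℚ.nonNegative (<⇒≤ (c-pos e))}} (χ-mono ((e , suc l) ∈ᵗ? S) (_ ∈ᵗ? S′) S⊆S′)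

  capacity-mono-⊆ : ∀ {S S′} → TimeEdgeSet N S → TimeEdgeSet N S′ → (∀ {x} → x ∈ S → x ∈ S′) →
                    capacity N S ≤ capacity N S′
  capacity-mono-⊆ {S} {S′} S-set S′-set S⊆S′ = begin
    capacity N S                          ≡⟨ capacity≡∑capacityAt S-set ⟩
    ∑[ l < lmax N ] capacityAt S (toℕ l)  ≤⟨ sum-mono-≤ {lmax N} (capacityAt-mono-⊆ S⊆S′ ∘ toℕ) ⟩
    ∑[ l < lmax N ] capacityAt S′ (toℕ l) ≡⟨ sym (capacity≡∑capacityAt S′-set) ⟩
    capacity N S′                         ∎
    where open ≤-Reasoning

  capacity-mono-⊂ : ∀ {S S′} → TimeEdgeSet N S → TimeEdgeSet N S′ → ProperSubset N S S′ → capacity N S < capacity N S′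
  capacity-mono-⊂ {S} {S′} (unique , S-edges) S′-set@(_ , S′-edges) (S⊆S′ , x , x∈S′ , x∉S) = begin-strict
    capacity N S                      <⟨ subst (_< c (proj₁ x) + capacity N S) (+-identityˡ (capacity N S))
                                           (+-monoˡ-< (capacity N S) (c-pos (proj₁ x))) ⟩
    c (proj₁ x) + capacity N S        ≤⟨ capacity-mono-⊆ (¬Any⇒All¬ _ x∉S ∷ unique , All.lookup S′-edges x∈S′ ∷ S-edges) S′-set
                                           (λ { (here refl) → x∈S′ ; (there y∈S) → S⊆S′ y∈S }) ⟩
    capacity N S′                     ∎
    where open ≤-Reasoning

  minimum⇒minimal : ∀ {S} → IsTemporalCut N S → (∀ S′ → IsTemporalCut N S′ → capacity N S ≤ capacity N S′) →
                    IsMinimalTemporalCut N S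
  minimum⇒minimal cut@(S-set , _) minimum =
    cut , λ S′ S′-set S′⊂S S′-cut → <-irrefl refl (<-≤-trans (capacity-mono-⊂ S′-set S-set S′⊂S) (minimum S′ S′-cut))

  -- Weak duality

  journey-weaken : ∀ {u l l′ js} → l′ ℕ.≤ l → JourneyToT N u l js → JourneyToT N u l′ js
  journey-weaken l′≤l arrive                 = arrive
  journey-weaken l′≤l (step src≡ l∈ l<l₁ js) = step src≡ l∈ (ℕ.≤-<-trans l′≤l l<l₁) js

  Escape : List (TimeEdge N) → ℕ → Fin n → ℕ → Set
  Escape S zero    v l = v ≡ t
  Escape S (suc k) v l = v ≡ t ⊎ Escape S k v (suc l)
    ⊎ Σ (Fin m) λ e → src e ≡ v × suc l ∈ L e × (e , suc l) ∉ S × Escape S k (tgt e) (suc l)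

  escape? : ∀ S k v l → Dec (Escape S k v l)
  escape? S zero    v l = v ≟ t
  escape? S (suc k) v l = v ≟ t ⊎-dec escape? S k v (suc l)
    ⊎-dec Fin.any? λ e → src e ≟ v ×-dec suc l ∈ℕ? L e ×-dec ¬? ((e , suc l) ∈ᵗ? S) ×-dec escape? S k (tgt e) (suc l)

  escape⇒journey : ∀ {S} k {v l} → Escape S k v l → Σ (List (TimeEdge N)) λ js → JourneyToT N v l js × All (_∉ S) js
  escape⇒journey zero    refl                          = [] , arrive , []
  escape⇒journey (suc k) (inj₁ refl)                   = [] , arrive , []
  escape⇒journey (suc k) (inj₂ (inj₁ esc))             with js , journey , avoids ← escape⇒journey k esc =
    js , journey-weaken (ℕ.n≤1+n _) journey , avoids
  escape⇒journey (suc k) (inj₂ (inj₂ (e , refl , l∈ , e∉S , esc))) with js , journey , avoids ← escape⇒journey k esc =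
    (e , _) ∷ js , step refl l∈ (ℕ.n<1+n _) journey , e∉S ∷ avoids

  private
    ∸-suc : ∀ {T l} → l ℕ.< T → T ∸ l ≡ suc (T ∸ suc l)
    ∸-suc {suc T} {zero}  _         = refl
    ∸-suc {suc T} {suc l} (s≤s l<T) = ∸-suc l<T

  module WeakDuality {S : List (TimeEdge N)} (cut : IsTemporalCut N S) where

    T : ℕ
    T = lmax N

    Alive : Fin n → ℕ → Set
    Alive v l = Escape S (T ∸ l) v l

    alive? : ∀ v l → Dec (Alive v l)
    alive? v l = escape? S (T ∸ l) v l

    α : Fin n → ℕ → ℚ
    α v l = χ (alive? v l)

    ¬alive-s : ∀ l → ¬ Alive s l
    ¬alive-s l esc with js , journey , avoids ← escape⇒journey (T ∸ l) esc
                   with x , x∈js , x∈S ← proj₂ cut js (journey-weaken z≤n journey) =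
      All.lookup avoids x∈js x∈S

    alive-t : ∀ l → Alive t l
    alive-t l with T ∸ l
    ... | zero  = refl
    ... | suc _ = inj₁ refl

    alive-late : ∀ {v l} → T ℕ.≤ l → Alive v l → v ≡ t
    alive-late {v} {l} T≤l = subst (λ k → Escape S k v l → v ≡ t) (sym (ℕ.m≤n⇒m∸n≡0 T≤l)) (λ v≡t → v≡t)

    alive-earlier : ∀ {v l} → Alive v (suc l) → Alive v l
    alive-earlier {v} {l} esc with l ℕ.<? T
    ... | yes l<T = subst (λ k → Escape S k v l) (sym (∸-suc l<T)) (inj₂ (inj₁ esc))
    ... | no l≮T  = subst (λ w → Alive w l) (sym (alive-late (ℕ.m≤n⇒m≤1+n (ℕ.≮⇒≥ l≮T)) esc)) (alive-t l)

    alive-edge : ∀ {e l} → suc l ∈ L e → (e , suc l) ∉ S → Alive (tgt e) (suc l) → Alive (src e) l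
    alive-edge {e} {l} l∈ e∉S esc =
      subst (λ k → Escape S k (src e) l) (sym (∸-suc (label≤lmax l∈))) (inj₂ (inj₂ (e , refl , l∈ , e∉S , esc)))

    -- Needed because buffers are constrained only at labels of incident edges.
    alive-lost : ∀ {v l} → Alive v l → ¬ Alive v (suc l) → Σ (Fin m) λ e → src e ≡ v × suc l ∈ L e
    alive-lost {v} {l} esc dead with l ℕ.<? T
    ... | no l≮T  = ⊥-elim (dead (subst (λ w → Alive w (suc l)) (sym (alive-late (ℕ.≮⇒≥ l≮T) esc)) (alive-t (suc l))))
    ... | yes l<T with subst (λ k → Escape S k v l) (∸-suc l<T) esc
    ...   | inj₁ refl                        = ⊥-elim (dead (alive-t (suc l)))
    ...   | inj₂ (inj₁ esc′)                 = ⊥-elim (dead esc′)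
    ...   | inj₂ (inj₂ (e , src≡ , l∈ , _)) = e , src≡ , l∈

    module _ (F : TemporalFlow N) where
      open TemporalFlow F
      open Potential F α

      private
        0≤χc : ∀ {p} {P : Set p} (d : Dec P) e → 0ℚ ≤ χ d * c e
        0≤χc d e = *-nonneg (χ-nonneg d) (<⇒≤ (c-pos e))

      gain-at≤ : ∀ l e → f e (suc l) * (α (tgt e) (suc l) - α (src e) l) ≤ χ ((e , suc l) ∈ᵗ? S) * c e
      gain-at≤ l e with alive? (tgt e) (suc l) | (e , suc l) ∈ᵗ? S
      ... | no _ | d = ≤-trans (*-nonpos (f-nonneg e (suc l)) (0-p≤0 (χ-nonneg (alive? (src e) l)))) (0≤χc d e)
        where
        0-p≤0 : ∀ {p} → 0ℚ ≤ p → 0ℚ - p ≤ 0ℚ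
        0-p≤0 {p} 0≤p = subst (_≤ 0ℚ) (sym (+-identityˡ (- p))) (neg-antimono-≤ 0≤p)
      ... | yes _ | yes _ = begin
        f e (suc l) * (1ℚ - α (src e) l) ≤⟨ *-monoˡ-≤-nonNeg (f e (suc l)) {{ℚ.nonNegative (f-nonneg e (suc l))}}
                                              (p-q≤p (χ-nonneg (alive? (src e) l))) ⟩
        f e (suc l) * 1ℚ                 ≡⟨ *-identityʳ _ ⟩
        f e (suc l)                      ≤⟨ f-cap e (suc l) ⟩
        c e                              ≡⟨ sym (*-identityˡ (c e)) ⟩
        1ℚ * c e                         ∎
        where open ≤-Reasoning
      ... | yes tgt-alive | no e∉S with suc l ∈ℕ? L e
      ...   | no l∉ rewrite f-zero e (suc l) (inj₂ l∉) = ≤-reflexive (trans (*-zeroˡ (1ℚ - α (src e) l)) (sym (*-zeroˡ (c e))))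
      ...   | yes l∈ rewrite χ-yes (alive? (src e) l) (alive-edge l∈ e∉S tgt-alive) | +-inverseʳ 1ℚ =
        ≤-reflexive (trans (*-zeroʳ (f e (suc l))) (sym (*-zeroˡ (c e))))

      loss-at≥0 : ∀ l v → 0ℚ ≤ (α v l - α v (suc l)) * bμ v (suc l)
      loss-at≥0 l v with alive? v l | alive? v (suc l)
      ... | yes _    | yes _    = ≤-reflexive (sym (trans (cong (_* bμ v (suc l)) (+-inverseʳ 1ℚ)) (*-zeroˡ (bμ v (suc l)))))
      ... | no _     | no _     = ≤-reflexive (sym (*-zeroˡ (bμ v (suc l))))
      ... | no dead  | yes live = ⊥-elim (dead (alive-earlier live))
      ... | yes live | no dead with v ≟ s
      ...   | yes refl = ⊥-elim (¬alive-s l live)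
      ...   | no v≢s with e , src≡v , l∈ ← alive-lost live dead =
        *-nonneg (nonNegative⁻¹ 1ℚ) (proj₁ (proj₂ (b-nonneg v v≢s (suc l) (inj₂ (e , inj₁ src≡v , l∈)))))

      gain-loss≤capacityAt : ∀ l → edgeGain l - bufferLoss l ≤ capacityAt S l
      gain-loss≤capacityAt l = begin
        edgeGain l - bufferLoss l ≤⟨ p-q≤p (sum-nonneg (loss-at≥0 l)) ⟩
        edgeGain l                ≤⟨ sum-mono-≤ (gain-at≤ l) ⟩
        capacityAt S l            ∎
        where open ≤-Reasoning

      value≤capacity : value N F ≤ capacity N S
      value≤capacity = begin
        value N F                                        ≡⟨ value≡∑gain (λ l _ → χ-no (alive? s l) (¬alive-s l))
                                                              (χ-yes (alive? t T) (alive-t T)) others-dead ⟩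
        ∑[ l < T ] (edgeGain (toℕ l) - bufferLoss (toℕ l)) ≤⟨ sum-mono-≤ {T} (gain-loss≤capacityAt ∘ toℕ) ⟩
        ∑[ l < T ] capacityAt S (toℕ l)                  ≡⟨ sym (capacity≡∑capacityAt (proj₁ cut)) ⟩
        capacity N S                                     ∎
        where
        open ≤-Reasoning
        others-dead : ∀ v → v ≢ t → α v T * b⁺ v T ≡ 0ℚ
        others-dead v v≢t rewrite χ-no (alive? v T) (v≢t ∘ alive-late ℕ.≤-refl) = *-zeroˡ (b⁺ v T)

  weak-duality : ∀ (F : TemporalFlow N) {S} → IsTemporalCut N S → value N F ≤ capacity N S
  weak-duality F cut = WeakDuality.value≤capacity cut F

  -- Linearity of the buffers in the edge flow

  flowAt-+ : ∀ end f g v l → flowAt end (λ e j → f e j + g e j) v l ≡ flowAt end f v l + flowAt end g v l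
  flowAt-+ end f g v l = trans (sum-cong-≗ λ e → *-distribˡ-+ (χ (end e ≟ v)) (f e l) (g e l))
                               (∑-distrib-+ (λ e → χ (end e ≟ v) * f e l) (λ e → χ (end e ≟ v) * g e l))

  B⁺-+ : ∀ f g v l → B⁺ (λ e j → f e j + g e j) v l ≡ B⁺ f v l + B⁺ g v l
  B⁺-+ f g v zero    = sym (+-identityʳ 0ℚ)
  B⁺-+ f g v (suc l) rewrite B⁺-+ f g v l | flowAt-+ src f g v (suc l) | flowAt-+ tgt f g v (suc l) =
    solve 6 (λ b b′ o o′ i i′ → b :+ b′ :- (o :+ o′) :+ (i :+ i′) := (b :- o :+ i) :+ (b′ :- o′ :+ i′)) refl
      (B⁺ f v l) (B⁺ g v l) (Out f v (suc l)) (Out g v (suc l)) (In f v (suc l)) (In g v (suc l))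

  Bμ-+ : ∀ f g v l → Bμ (λ e j → f e j + g e j) v l ≡ Bμ f v l + Bμ g v l
  Bμ-+ f g v zero    = sym (+-identityʳ 0ℚ)
  Bμ-+ f g v (suc l) rewrite B⁺-+ f g v l | flowAt-+ src f g v (suc l) =
    solve 4 (λ b b′ o o′ → b :+ b′ :- (o :+ o′) := (b :- o) :+ (b′ :- o′)) refl
      (B⁺ f v l) (B⁺ g v l) (Out f v (suc l)) (Out g v (suc l))

  B⁺-0 : ∀ v l → B⁺ (λ _ _ → 0ℚ) v l ≡ 0ℚ
  B⁺-0 v zero    = refl
  B⁺-0 v (suc l) rewrite B⁺-0 v l | sum-zero {m} (λ e → *-zeroʳ (χ (src e ≟ v)))
                       | sum-zero {m} (λ e → *-zeroʳ (χ (tgt e ≟ v))) = refl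

  Bμ-0 : ∀ v l → Bμ (λ _ _ → 0ℚ) v l ≡ 0ℚ
  Bμ-0 v zero    = refl
  Bμ-0 v (suc l) rewrite B⁺-0 v l | sum-zero {m} (λ e → *-zeroʳ (χ (src e ≟ v))) = refl

  pulse : ℚ → TimeEdge N → Fin m → ℕ → ℚ
  pulse a x e j = a * χ ((e , j) ≟ᵗ x)

  flowAt-pulse : ∀ end a e₀ j₀ v j → flowAt end (pulse a (e₀ , j₀)) v j ≡ a * (χ (end e₀ ≟ v) * χ (j ℕ.≟ j₀))
  flowAt-pulse end a e₀ j₀ v j = trans (sum-single _ e₀ other) (trans same
    (solve 3 (λ x y z → x :* (y :* z) := y :* (x :* z)) refl (χ (end e₀ ≟ v)) a (χ (j ℕ.≟ j₀))))
    where
    other : ∀ e → e ≢ e₀ → χ (end e ≟ v) * pulse a (e₀ , j₀) e j ≡ 0ℚ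
    other e e≢e₀ = trans (cong (λ χ₀ → χ (end e ≟ v) * (a * χ₀)) (χ-no ((e , j) ≟ᵗ (e₀ , j₀)) (e≢e₀ ∘ cong proj₁)))
                         (trans (cong (χ (end e ≟ v) *_) (*-zeroʳ a)) (*-zeroʳ (χ (end e ≟ v))))
    same : χ (end e₀ ≟ v) * pulse a (e₀ , j₀) e₀ j ≡ χ (end e₀ ≟ v) * (a * χ (j ℕ.≟ j₀))
    same = cong (λ χ₀ → χ (end e₀ ≟ v) * (a * χ₀)) (χ-cong ((e₀ , j) ≟ᵗ (e₀ , j₀)) (j ℕ.≟ j₀) (cong proj₂) (cong (e₀ ,_)))

  B⁺-pulse : ∀ a e k v l → B⁺ (pulse a (e , suc k)) v l ≡ a * (χ (tgt e ≟ v) - χ (src e ≟ v)) * χ (suc k ℕ.≤? l)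
  B⁺-pulse a e k v zero = sym (*-zeroʳ (a * (χ (tgt e ≟ v) - χ (src e ≟ v))))
  B⁺-pulse a e k v (suc l) = begin
    B⁺ (pulse a (e , suc k)) v l - Out (pulse a (e , suc k)) v (suc l) + In (pulse a (e , suc k)) v (suc l)
      ≡⟨ cong₂ (λ b o → b - o + In (pulse a (e , suc k)) v (suc l)) (B⁺-pulse a e k v l) (flowAt-pulse src a e (suc k) v (suc l)) ⟩
    a * (T - S) * χ (suc k ℕ.≤? l) - a * (S * χ (suc l ℕ.≟ suc k)) + In (pulse a (e , suc k)) v (suc l)
      ≡⟨ cong (a * (T - S) * χ (suc k ℕ.≤? l) - a * (S * χ (suc l ℕ.≟ suc k)) +_) (flowAt-pulse tgt a e (suc k) v (suc l)) ⟩
    a * (T - S) * χ (suc k ℕ.≤? l) - a * (S * χ (suc l ℕ.≟ suc k)) + a * (T * χ (suc l ℕ.≟ suc k))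
      ≡⟨ solve 5 (λ a T S le eq → a :* (T :- S) :* le :- a :* (S :* eq) :+ a :* (T :* eq) := a :* (T :- S) :* (le :+ eq)) refl
                 a T S (χ (suc k ℕ.≤? l)) (χ (suc l ℕ.≟ suc k)) ⟩
    a * (T - S) * (χ (suc k ℕ.≤? l) + χ (suc l ℕ.≟ suc k))
      ≡⟨ cong (a * (T - S) *_) (sym (χ-⊎ (suc k ℕ.≤? suc l) (suc k ℕ.≤? l) (suc l ℕ.≟ suc k)
                   (Sum.map ℕ.≤-pred sym ∘ ℕ.m≤n⇒m<n∨m≡n) ℕ.m≤n⇒m≤1+n (ℕ.≤-reflexive ∘ sym)
                   (λ k<l → ℕ.<⇒≢ k<l ∘ sym ∘ ℕ.suc-injective))) ⟩
    a * (T - S) * χ (suc k ℕ.≤? suc l) ∎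
    where
    open ≡-Reasoning
    T = χ (tgt e ≟ v)
    S = χ (src e ≟ v)

  Bμ-pulse : ∀ a e k v l → Bμ (pulse a (e , suc k)) v (suc l) ≡ a * (χ (tgt e ≟ v) * χ (suc k ℕ.≤? l) - χ (src e ≟ v) * χ (k ℕ.≤? l))
  Bμ-pulse a e k v l = begin
    B⁺ (pulse a (e , suc k)) v l - Out (pulse a (e , suc k)) v (suc l)
      ≡⟨ cong₂ _-_ (B⁺-pulse a e k v l) (flowAt-pulse src a e (suc k) v (suc l)) ⟩
    a * (T - S) * χ (suc k ℕ.≤? l) - a * (S * χ (suc l ℕ.≟ suc k))
      ≡⟨ solve 5 (λ a T S le eq → a :* (T :- S) :* le :- a :* (S :* eq) := a :* (T :* le :- S :* (le :+ eq))) refl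
                 a T S (χ (suc k ℕ.≤? l)) (χ (suc l ℕ.≟ suc k)) ⟩
    a * (T * χ (suc k ℕ.≤? l) - S * (χ (suc k ℕ.≤? l) + χ (suc l ℕ.≟ suc k)))
      ≡⟨ cong (λ le → a * (T * χ (suc k ℕ.≤? l) - S * le)) (sym (χ-⊎ (k ℕ.≤? l) (suc k ℕ.≤? l) (suc l ℕ.≟ suc k)
                   (Sum.map₂ (cong suc ∘ sym) ∘ ℕ.m≤n⇒m<n∨m≡n) ℕ.<⇒≤ (ℕ.≤-reflexive ∘ ℕ.suc-injective ∘ sym)
                   (λ k<l → ℕ.<⇒≢ k<l ∘ sym ∘ ℕ.suc-injective))) ⟩
    a * (T * χ (suc k ℕ.≤? l) - S * χ (k ℕ.≤? l)) ∎
    where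
    open ≡-Reasoning
    T = χ (tgt e ≟ v)
    S = χ (src e ≟ v)

  -- The time-expanded residual network

  State : Set
  State = Fin n × ℕ

  _≟ˢ_ : DecidableEquality State
  _≟ˢ_ = ≡-dec _≟_ ℕ._≟_

  open import Data.List.Membership.DecPropositional _≟ˢ_ using () renaming (_∈?_ to _∈ˢ?_)

  states≤lmax : List State
  states≤lmax = cartesianProduct (allFin n) (upTo (suc (lmax N)))

  ∈-states≤lmax : ∀ {v l} → l ℕ.≤ lmax N → (v , l) ∈ states≤lmax
  ∈-states≤lmax l≤T = ∈-cartesianProduct⁺ (∈-allFin _) (∈-upTo⁺ (s≤s l≤T))

  ζ : Fin n → ℕ → State → ℚ
  ζ v l (w , j) = χ (w ≟ v) * χ (j ℕ.≤? l)

  -- The residual network of f for augmentation by u, on the states (v , l) meaning "in v's buffer after time l".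
  module Residual (u : ℚ) (f : Fin m → ℕ → ℚ) where

    data Step : State → State → Set where
      wait   : ∀ {v l} → suc l ℕ.≤ lmax N → Step (v , l) (v , suc l)
      unwait : ∀ {v l} → u ≤ Bμ f v (suc l) → Step (v , suc l) (v , l)
      push   : ∀ {e l} → suc l ∈ L e → f e (suc l) + u ≤ c e → Step (src e , l) (tgt e , suc l)
      pull   : ∀ {e l} → suc l ∈ L e → u ≤ f e (suc l) → Step (tgt e , suc l) (src e , l)

    step? : ∀ x y → Dec (Step x y)
    step? (v , l) (w , l′) = map′ fromSum toSum
      ((v ≟ w ×-dec l′ ℕ.≟ suc l ×-dec suc l ℕ.≤? lmax N)
      ⊎-dec (v ≟ w ×-dec l ℕ.≟ suc l′ ×-dec u ≤? Bμ f v l)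
      ⊎-dec Fin.any? (λ e → src e ≟ v ×-dec tgt e ≟ w ×-dec l′ ℕ.≟ suc l ×-dec l′ ∈ℕ? L e ×-dec f e l′ + u ≤? c e)
      ⊎-dec Fin.any? (λ e → tgt e ≟ v ×-dec src e ≟ w ×-dec l ℕ.≟ suc l′ ×-dec l ∈ℕ? L e ×-dec u ≤? f e l))
      where
      fromSum : _ → Step (v , l) (w , l′)
      fromSum (inj₁ (refl , refl , room))                                  = wait room
      fromSum (inj₂ (inj₁ (refl , refl , held)))                           = unwait held
      fromSum (inj₂ (inj₂ (inj₁ (e , refl , refl , refl , l∈ , room))))    = push l∈ room
      fromSum (inj₂ (inj₂ (inj₂ (e , refl , refl , refl , l∈ , carried)))) = pull l∈ carried
      toSum : Step (v , l) (w , l′) → _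
      toSum (wait room)             = inj₁ (refl , refl , room)
      toSum (unwait held)           = inj₂ (inj₁ (refl , refl , held))
      toSum (push {e} l∈ room)      = inj₂ (inj₂ (inj₁ (e , refl , refl , refl , l∈ , room)))
      toSum (pull {e} l∈ carried)   = inj₂ (inj₂ (inj₂ (e , refl , refl , refl , l∈ , carried)))

    step-≤lmax : ∀ {v l w l′} → Step (v , l) (w , l′) → l ℕ.≤ lmax N → l′ ℕ.≤ lmax N
    step-≤lmax (wait room)   _   = room
    step-≤lmax (unwait _)    l≤T = ℕ.≤-trans (ℕ.n≤1+n _) l≤T
    step-≤lmax (push l∈ _)   _   = label≤lmax l∈
    step-≤lmax (pull _ _)    l≤T = ℕ.≤-trans (ℕ.n≤1+n _) l≤T

    infixl 5 _▸_
    data Path : State → Set where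
      []  : Path (s , 0)
      _▸_ : ∀ {x y} → Path x → Step x y → Path y

    states : ∀ {y} → Path y → List State
    states {y} []    = y ∷ []
    states {y} (p ▸ _) = y ∷ states p

    steps : ∀ {y} → Path y → ℕ
    steps []      = 0
    steps (p ▸ _) = suc (steps p)

    length-states : ∀ {y} (p : Path y) → length (states p) ≡ suc (steps p)
    length-states []      = refl
    length-states (p ▸ _) = cong suc (length-states p)

    end∈states : ∀ {y} (p : Path y) → y ∈ states p
    end∈states []      = here refl
    end∈states (_ ▸ _) = here refl

    states-≤lmax : ∀ {y} (p : Path y) → All (λ z → proj₂ z ℕ.≤ lmax N) (states p)
    states-≤lmax []       = z≤n ∷ []
    states-≤lmax (p ▸ st) = step-≤lmax st (All.lookup (states-≤lmax p) (end∈states p)) ∷ states-≤lmax p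

    Simple : ∀ {y} → Path y → Set
    Simple p = Unique (states p)

    private
      cut-at : ∀ {x y} (p : Path x) → Simple p → y ∈ states p → Σ (Path y) Simple
      cut-at []       simple      (here refl)   = [] , simple
      cut-at (p ▸ st) simple      (here refl)   = p ▸ st , simple
      cut-at (p ▸ st) (_ ∷ simple) (there y∈p) = cut-at p simple y∈p

    loop-erase : ∀ {y} → Path y → Σ (Path y) Simple
    loop-erase [] = [] , [] ∷ []
    loop-erase {y} (p ▸ st) with loop-erase p
    ... | q , simple with y ∈ˢ? states q
    ...   | yes y∈q = cut-at q simple y∈q
    ...   | no y∉q  = q ▸ st , ¬Any⇒All¬ _ y∉q ∷ simple

    Reach : ℕ → State → Set
    Reach k y = Σ (Path y) λ p → steps p ℕ.≤ k

    reach? : ∀ k y → Dec (Reach k y)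
    reach? zero y with y ≟ˢ (s , 0)
    ... | yes refl = yes ([] , z≤n)
    ... | no y≢s₀  = no λ { ([] , _) → y≢s₀ refl ; (_ ▸ _ , ()) }
    reach? (suc k) y with reach? k y
    ... | yes (p , p≤k) = yes (p , ℕ.m≤n⇒m≤1+n p≤k)
    ... | no ¬reach with Any.any? (λ x → reach? k x ×-dec step? x y) states≤lmax
    ...   | yes last-step with _ , _ , (p , p≤k) , st ← find last-step = yes (p ▸ st , s≤s p≤k)
    ...   | no ¬last-step = no λ
      { ([] , _)               → ¬reach ([] , z≤n)
      ; (p ▸ st , s≤s p≤k) → ¬last-step (lose (∈-states≤lmax (All.lookup (states-≤lmax p) (end∈states p))) ((p , p≤k) , st))
      }

    Reachable : State → Set
    Reachable = Reach (length states≤lmax)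

    reachable? : ∀ y → Dec (Reachable y)
    reachable? = reach? (length states≤lmax)

    reachable-source : Reachable (s , 0)
    reachable-source = [] , z≤n

    -- Loop erasure keeps every path within the number of states of the time window.
    reachable-step : ∀ {x y} → Reachable x → Step x y → Reachable y
    reachable-step (p , _) st with q , simple ← loop-erase (p ▸ st) =
      q , ℕ.≤-trans (ℕ.n≤1+n (steps q)) (subst (ℕ._≤ length states≤lmax) (length-states q)
            (unique-⊆⇒length≤ simple λ z∈q → ∈-states≤lmax (All.lookup (states-≤lmax q) z∈q)))

    δ : ∀ {x y} → Step x y → Fin m → ℕ → ℚ
    δ (wait _)           _ _ = 0ℚ
    δ (unwait _)         _ _ = 0ℚ
    δ (push {e} {l} _ _) = pulse u (e , suc l)
    δ (pull {e} {l} _ _) = pulse (- u) (e , suc l)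

    -- ω st v l counts the crossings of st from (v , l) to (v , suc l), backward ones negatively.
    ω : ∀ {x y} → Step x y → Fin n → ℕ → ℚ
    ω (wait {v} {l} _)   w j = χ ((v , l) ≟ˢ (w , j))
    ω (unwait {v} {l} _) w j = - χ ((v , l) ≟ˢ (w , j))
    ω (push _ _)         _ _ = 0ℚ
    ω (pull _ _)         _ _ = 0ℚ

    Δ : ∀ {y} → Path y → Fin m → ℕ → ℚ
    Δ []       _ _ = 0ℚ
    Δ (p ▸ st) e j = Δ p e j + δ st e j

    Ω : ∀ {y} → Path y → Fin n → ℕ → ℚ
    Ω []       _ _ = 0ℚ
    Ω (p ▸ st) v l = Ω p v l + ω st v l

    private
      χ-≤-split : ∀ k l → χ (k ℕ.≤? l) ≡ χ (suc k ℕ.≤? l) + χ (k ℕ.≟ l)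
      χ-≤-split k l = χ-⊎ (k ℕ.≤? l) (suc k ℕ.≤? l) (k ℕ.≟ l) ℕ.m≤n⇒m<n∨m≡n ℕ.<⇒≤ ℕ.≤-reflexive ℕ.<⇒≢

      χ-≟ˢ : ∀ v l w j → χ ((v , l) ≟ˢ (w , j)) ≡ χ (v ≟ w) * χ (l ℕ.≟ j)
      χ-≟ˢ v l w j = χ-× ((v , l) ≟ˢ (w , j)) (v ≟ w) (l ℕ.≟ j) (λ { refl → refl , refl }) (λ { refl refl → refl })

    Bμ-δ : ∀ {x y} (st : Step x y) v l → Bμ (δ st) v (suc l) ≡ u * (ζ v l y - ζ v l x + ω st v l)
    Bμ-δ (wait {v′} {l′} _) v l = begin
      Bμ (λ _ _ → 0ℚ) v (suc l)                        ≡⟨ Bμ-0 v (suc l) ⟩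
      0ℚ                                               ≡⟨ solve 4 (λ u V a b → con 0ℚ := u :* (V :* a :- V :* (a :+ b) :+ V :* b)) refl u V a b ⟩
      u * (V * a - V * (a + b) + V * b)                ≡⟨ cong₂ (λ a+b Vb → u * (V * a - V * a+b + Vb)) (sym (χ-≤-split l′ l)) (sym (χ-≟ˢ v′ l′ v l)) ⟩
      u * (V * a - V * χ (l′ ℕ.≤? l) + χ ((v′ , l′) ≟ˢ (v , l))) ∎
      where
      open ≡-Reasoning
      V = χ (v′ ≟ v)
      a = χ (suc l′ ℕ.≤? l)
      b = χ (l′ ℕ.≟ l)
    Bμ-δ (unwait {v′} {l′} _) v l = begin
      Bμ (λ _ _ → 0ℚ) v (suc l)                        ≡⟨ Bμ-0 v (suc l) ⟩
      0ℚ                                               ≡⟨ solve 4 (λ u V a b → con 0ℚ := u :* (V :* (a :+ b) :- V :* a :+ :- (V :* b))) refl u V a b ⟩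
      u * (V * (a + b) - V * a + - (V * b))            ≡⟨ cong₂ (λ a+b Vb → u * (V * a+b - V * a + - Vb)) (sym (χ-≤-split l′ l)) (sym (χ-≟ˢ v′ l′ v l)) ⟩
      u * (V * χ (l′ ℕ.≤? l) - V * a + - χ ((v′ , l′) ≟ˢ (v , l))) ∎
      where
      open ≡-Reasoning
      V = χ (v′ ≟ v)
      a = χ (suc l′ ℕ.≤? l)
      b = χ (l′ ℕ.≟ l)
    Bμ-δ (push {e} {k} _ _) v l = trans (Bμ-pulse u e k v l)
      (solve 5 (λ u T a S b → u :* (T :* a :- S :* b) := u :* (T :* a :- S :* b :+ con 0ℚ)) refl
        u (χ (tgt e ≟ v)) (χ (suc k ℕ.≤? l)) (χ (src e ≟ v)) (χ (k ℕ.≤? l)))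
    Bμ-δ (pull {e} {k} _ _) v l = trans (Bμ-pulse (- u) e k v l)
      (solve 5 (λ u T a S b → (:- u) :* (T :* a :- S :* b) := u :* (S :* b :- T :* a :+ con 0ℚ)) refl
        u (χ (tgt e ≟ v)) (χ (suc k ℕ.≤? l)) (χ (src e ≟ v)) (χ (k ℕ.≤? l)))

    -- What is pushed along p rests in the buffers p waits in, and in the buffer at the end of p.
    Bμ-Δ : ∀ {y} (p : Path y) v l → Bμ (Δ p) v (suc l) ≡ u * (ζ v l y - ζ v l (s , 0) + Ω p v l)
    Bμ-Δ [] v l = trans (Bμ-0 v (suc l)) (solve 2 (λ u z → con 0ℚ := u :* (z :- z :+ con 0ℚ)) refl u (ζ v l (s , 0)))
    Bμ-Δ (_▸_ {x} {y} p st) v l =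
      trans (Bμ-+ (Δ p) (δ st) v (suc l)) (trans (cong₂ _+_ (Bμ-Δ p v l) (Bμ-δ st v l))
        (solve 6 (λ u zx z₀ Ωp zy ωs → u :* (zx :- z₀ :+ Ωp) :+ u :* (zy :- zx :+ ωs) := u :* (zy :- z₀ :+ (Ωp :+ ωs))) refl
          u (ζ v l x) (ζ v l (s , 0)) (Ω p v l) (ζ v l y) (ω st v l)))

    δ-untouched : ∀ {x y} (st : Step x y) {e k z} → z ≡ (src e , k) ⊎ z ≡ (tgt e , suc k) → z ≢ x → z ≢ y →
                  δ st e (suc k) ≡ 0ℚ
    δ-untouched (wait _)   _ _ _ = refl
    δ-untouched (unwait _) _ _ _ = refl
    δ-untouched (push {e′} {k′} _ _) {e} {k} z-end z≢x z≢y with (e , suc k) ≟ᵗ (e′ , suc k′)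
    ... | yes refl = ⊥-elim ([ z≢x , z≢y ] z-end)
    ... | no _     = *-zeroʳ u
    δ-untouched (pull {e′} {k′} _ _) {e} {k} z-end z≢x z≢y with (e , suc k) ≟ᵗ (e′ , suc k′)
    ... | yes refl = ⊥-elim ([ z≢y , z≢x ] z-end)
    ... | no _     = *-zeroʳ (- u)

    ω-untouched : ∀ {x y} (st : Step x y) {v l z} → z ≡ (v , l) ⊎ z ≡ (v , suc l) → z ≢ x → z ≢ y → ω st v l ≡ 0ℚ
    ω-untouched (wait {v′} {l′} _) {v} {l} z-end z≢x z≢y with (v′ , l′) ≟ˢ (v , l)
    ... | yes refl = ⊥-elim ([ z≢x , z≢y ] z-end)
    ... | no _     = refl
    ω-untouched (unwait {v′} {l′} _) {v} {l} z-end z≢x z≢y with (v′ , l′) ≟ˢ (v , l)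
    ... | yes refl = ⊥-elim ([ z≢y , z≢x ] z-end)
    ... | no _     = refl
    ω-untouched (push _ _) _ _ _ = refl
    ω-untouched (pull _ _) _ _ _ = refl

    Δ-untouched : ∀ {y} (p : Path y) {e k z} → z ≡ (src e , k) ⊎ z ≡ (tgt e , suc k) → z ∉ states p → Δ p e (suc k) ≡ 0ℚ
    Δ-untouched []                   _     _   = refl
    Δ-untouched (_▸_ {x} p st) z-end z∉p =
      trans (cong₂ _+_ (Δ-untouched p z-end (z∉p ∘ there))
                       (δ-untouched st z-end (λ { refl → z∉p (there (end∈states p)) }) (z∉p ∘ here)))
            (+-identityʳ 0ℚ)

    Ω-untouched : ∀ {y} (p : Path y) {v l z} → z ≡ (v , l) ⊎ z ≡ (v , suc l) → z ∉ states p → Ω p v l ≡ 0ℚ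
    Ω-untouched []                   _     _   = refl
    Ω-untouched (_▸_ {x} p st) z-end z∉p =
      trans (cong₂ _+_ (Ω-untouched p z-end (z∉p ∘ there))
                       (ω-untouched st z-end (λ { refl → z∉p (there (end∈states p)) }) (z∉p ∘ here)))
            (+-identityʳ 0ℚ)

    Δ-off-labels : ∀ {y} (p : Path y) e j → j ≡ 0 ⊎ j ∉ L e → Δ p e j ≡ 0ℚ
    Δ-off-labels []       e j _      = refl
    Δ-off-labels (p ▸ st) e j off-label = trans (cong₂ _+_ (Δ-off-labels p e j off-label) (δ-off st)) (+-identityʳ 0ℚ)
      where
      δ-off : ∀ {x y} (st : Step x y) → δ st e j ≡ 0ℚ
      δ-off (wait _)   = refl
      δ-off (unwait _) = refl
      δ-off (push {e′} {k′} l∈ _) with (e , j) ≟ᵗ (e′ , suc k′)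
      ... | yes refl = ⊥-elim ([ (λ ()) , (λ l∉ → l∉ l∈) ] off-label)
      ... | no _     = *-zeroʳ u
      δ-off (pull {e′} {k′} l∈ _) with (e , j) ≟ᵗ (e′ , suc k′)
      ... | yes refl = ⊥-elim ([ (λ ()) , (λ l∉ → l∉ l∈) ] off-label)
      ... | no _     = *-zeroʳ (- u)

    Δ-multiple : ∀ {y} (p : Path y) e j → IntMultiple u (Δ p e j)
    Δ-multiple []       e j = multiple-0
    Δ-multiple (p ▸ st) e j = multiple-+ (Δ-multiple p e j) (δ-multiple st)
      where
      δ-multiple : ∀ {x y} (st : Step x y) → IntMultiple u (δ st e j)
      δ-multiple (wait _)             = multiple-0
      δ-multiple (unwait _)           = multiple-0
      δ-multiple (push {e′} {k′} _ _) = subst (IntMultiple u) (*-comm _ u) (multiple-χ* ((e , j) ≟ᵗ (e′ , suc k′)) multiple-self)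
      δ-multiple (pull {e′} {k′} _ _) = subst (IntMultiple u) (*-comm _ (- u)) (multiple-χ* ((e , j) ≟ᵗ (e′ , suc k′)) (multiple-neg multiple-self))

    module _ (0≤u : 0ℚ ≤ u) (f≥0 : ∀ e j → 0ℚ ≤ f e j) (f≤c : ∀ e j → f e j ≤ c e) where

      private
        Within : Fin m → ℚ → Set
        Within e q = 0ℚ ≤ q × q ≤ c e

        u*0 : ∀ q → q + u * 0ℚ ≡ q
        u*0 q = trans (cong (q +_) (*-zeroʳ u)) (+-identityʳ q)

        -u*0 : ∀ q → q + - u * 0ℚ ≡ q
        -u*0 q = trans (cong (q +_) (*-zeroʳ (- u))) (+-identityʳ q)

      -- Along a simple path every time edge is augmented at most once, so capacities are respected.
      Δ-within-capacity : ∀ {y} (p : Path y) → Simple p → ∀ e j → Within e (f e j + Δ p e j)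
      Δ-within-capacity [] _ e j = subst (Within e) (sym (+-identityʳ (f e j))) (f≥0 e j , f≤c e j)
      Δ-within-capacity (p ▸ wait _) (_ ∷ simple) e j =
        subst (Within e) (cong (f e j +_) (sym (+-identityʳ (Δ p e j)))) (Δ-within-capacity p simple e j)
      Δ-within-capacity (p ▸ unwait _) (_ ∷ simple) e j =
        subst (Within e) (cong (f e j +_) (sym (+-identityʳ (Δ p e j)))) (Δ-within-capacity p simple e j)
      Δ-within-capacity (p ▸ push {e′} {k′} _ room) (y∉p ∷ simple) e j with (e , j) ≟ᵗ (e′ , suc k′)
      ... | no _     = subst (Within e) (cong (f e j +_) (sym (u*0 (Δ p e j)))) (Δ-within-capacity p simple e j)
      ... | yes refl = subst (Within e) (cong (f e j +_) (sym fresh)) (+-mono-≤ (f≥0 e j) 0≤u , room)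
        where
        fresh : Δ p e j + u * 1ℚ ≡ u
        fresh = trans (cong₂ _+_ (Δ-untouched p (inj₂ refl) (All¬⇒¬Any y∉p)) (*-identityʳ u)) (+-identityˡ u)
      Δ-within-capacity (p ▸ pull {e′} {k′} _ carried) (y∉p ∷ simple) e j with (e , j) ≟ᵗ (e′ , suc k′)
      ... | no _     = subst (Within e) (cong (f e j +_) (sym (-u*0 (Δ p e j)))) (Δ-within-capacity p simple e j)
      ... | yes refl = subst (Within e) (cong (f e j +_) (sym fresh)) (p≤q⇒0≤q-p carried , ≤-trans (p-q≤p 0≤u) (f≤c e j))
        where
        fresh : Δ p e j + - u * 1ℚ ≡ - u
        fresh = trans (cong₂ _+_ (Δ-untouched p (inj₁ refl) (All¬⇒¬Any y∉p)) (*-identityʳ (- u))) (+-identityˡ (- u))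

      -- Along a simple path every buffer is crossed at most once, and backwards only if it holds u.
      Ω-within-buffer : ∀ {y} (p : Path y) → Simple p → ∀ v l → 0ℚ ≤ Bμ f v (suc l) → 0ℚ ≤ Bμ f v (suc l) + u * Ω p v l
      Ω-within-buffer [] _ v l 0≤b = subst (0ℚ ≤_) (sym (trans (cong (Bμ f v (suc l) +_) (*-zeroʳ u)) (+-identityʳ _))) 0≤b
      Ω-within-buffer (p ▸ wait {v′} {l′} _) (y∉p ∷ simple) v l 0≤b with (v′ , l′) ≟ˢ (v , l)
      ... | no _     = subst (0ℚ ≤_) (cong (λ ω → Bμ f v (suc l) + u * ω) (sym (+-identityʳ (Ω p v l))))
                         (Ω-within-buffer p simple v l 0≤b)
      ... | yes refl = subst (0ℚ ≤_) (cong (λ ω → Bμ f v (suc l) + u * ω) (sym fresh))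
                         (+-mono-≤ 0≤b (subst (0ℚ ≤_) (sym (*-identityʳ u)) 0≤u))
        where
        fresh : Ω p v l + 1ℚ ≡ 1ℚ
        fresh = trans (cong (_+ 1ℚ) (Ω-untouched p (inj₂ refl) (All¬⇒¬Any y∉p))) (+-identityˡ 1ℚ)
      Ω-within-buffer (p ▸ unwait {v′} {l′} held) (y∉p ∷ simple) v l 0≤b with (v′ , l′) ≟ˢ (v , l)
      ... | no _     = subst (0ℚ ≤_) (cong (λ ω → Bμ f v (suc l) + u * ω) (sym (+-identityʳ (Ω p v l))))
                         (Ω-within-buffer p simple v l 0≤b)
      ... | yes refl = subst (0ℚ ≤_) (sym fresh) (p≤q⇒0≤q-p held)
        where
        fresh : Bμ f v (suc l) + u * (Ω p v l + - 1ℚ) ≡ Bμ f v (suc l) - u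
        fresh = trans (cong (λ ω → Bμ f v (suc l) + u * (ω + - 1ℚ)) (Ω-untouched p (inj₁ refl) (All¬⇒¬Any y∉p)))
                      (solve 2 (λ b u → b :+ u :* (con 0ℚ :+ :- con 1ℚ) := b :- u) refl (Bμ f v (suc l)) u)
      Ω-within-buffer (p ▸ push _ _) (_ ∷ simple) v l 0≤b =
        subst (0ℚ ≤_) (cong (λ ω → Bμ f v (suc l) + u * ω) (sym (+-identityʳ (Ω p v l)))) (Ω-within-buffer p simple v l 0≤b)
      Ω-within-buffer (p ▸ pull _ _) (_ ∷ simple) v l 0≤b =
        subst (0ℚ ≤_) (cong (λ ω → Bμ f v (suc l) + u * ω) (sym (+-identityʳ (Ω p v l)))) (Ω-within-buffer p simple v l 0≤b)

  -- Ford–Fulkerson iteration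

  Bμ≡B⁺ : ∀ f v l → Out f v (suc l) ≡ 0ℚ → Bμ f v (suc l) ≡ B⁺ f v l
  Bμ≡B⁺ f v l no-out = trans (cong (λ o → B⁺ f v l - o) no-out) (+-identityʳ (B⁺ f v l))

  Bμ-sink : ∀ f l → Bμ f t (suc l) ≡ B⁺ f t l
  Bμ-sink f l = Bμ≡B⁺ f t l (sum-zero λ e → trans (cong (_* f e (suc l)) (χ-no (src e ≟ t) (noOutOfT e))) (*-zeroˡ (f e (suc l))))

  timeEdges : List (TimeEdge N)
  timeEdges = filter (λ x → proj₂ x ∈ℕ? L (proj₁ x)) (cartesianProduct (allFin m) (upTo (suc (lmax N))))

  ∈-timeEdges : ∀ {e l} → l ∈ L e → (e , l) ∈ timeEdges
  ∈-timeEdges l∈ = ∈-filter⁺ (λ x → proj₂ x ∈ℕ? L (proj₁ x)) (∈-cartesianProduct⁺ (∈-allFin _) (∈-upTo⁺ (s≤s (label≤lmax l∈)))) l∈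

  timeEdges-set : TimeEdgeSet N timeEdges
  timeEdges-set = filter⁺ _ (cartesianProduct⁺ (allFin⁺ m) (upTo⁺ (suc (lmax N))))
                , All.tabulate (proj₂ ∘ ∈-filter⁻ (λ x → proj₂ x ∈ℕ? L (proj₁ x)) {xs = cartesianProduct (allFin m) (upTo (suc (lmax N)))})

  timeEdges-cut : IsTemporalCut N timeEdges
  timeEdges-cut = timeEdges-set , λ _ journey → first-edge s≢t journey
    where
    first-edge : ∀ {v l js} → v ≢ t → JourneyToT N v l js → Σ (TimeEdge N) λ x → x ∈ js × x ∈ timeEdges
    first-edge v≢t arrive                   = ⊥-elim (v≢t refl)
    first-edge _   (step {e = e} _ l∈ _ _) = (e , _) , here refl , ∈-timeEdges l∈

  capacity-multiple : ∀ {u} → (∀ e → IntMultiple u (c e)) → ∀ S → IntMultiple u (capacity N S)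
  capacity-multiple c-multiple []            = multiple-0
  capacity-multiple c-multiple ((e , _) ∷ S) = multiple-+ (c-multiple e) (capacity-multiple c-multiple S)

  module FordFulkerson (u : ℚ) (0<u : 0ℚ < u) where
    open Residual u

    T : ℕ
    T = lmax N

    record Invariant (f : Fin m → ℕ → ℚ) : Set where
      field
        feasible : Feasible f
        integral : ∀ e j → IntMultiple u (f e j)
        drained  : ∀ v → v ≢ s → v ≢ t → Bμ f v (suc T) ≡ 0ℚ

    private
      ζ-elsewhere : ∀ {v w} l j → w ≢ v → ζ v l (w , j) ≡ 0ℚ
      ζ-elsewhere {v = v} {w} l j w≢v = trans (cong (_* χ (j ℕ.≤? l)) (χ-no (w ≟ v) w≢v)) (*-zeroˡ (χ (j ℕ.≤? l)))

    module Augmentation {f} (inv : Invariant f) (p : Path f (t , T)) (simple : Simple f p) where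
      open Invariant inv
      open Feasible feasible

      augmented : Fin m → ℕ → ℚ
      augmented e j = f e j + Δ f p e j

      Bμ-augmented : ∀ v l → Bμ augmented v (suc l) ≡ Bμ f v (suc l) + u * (ζ v l (t , T) - ζ v l (s , 0) + Ω f p v l)
      Bμ-augmented v l = trans (Bμ-+ f (Δ f p) v (suc l)) (cong (Bμ f v (suc l) +_) (Bμ-Δ f p v l))

      Ω-at-lmax : ∀ v → Ω f p v T ≡ 0ℚ
      Ω-at-lmax v = Ω-untouched f p (inj₂ refl) λ z∈p → ℕ.<-irrefl refl (All.lookup (states-≤lmax f p) z∈p)

      augmented-feasible : Feasible augmented
      augmented-feasible = record
        { nonneg     = λ e j → proj₁ (within e j)
        ; ≤cap       = λ e j → proj₂ (within e j)
        ; off-labels = λ e j off → trans (cong₂ _+_ (off-labels e j off) (Δ-off-labels f p e j off)) (+-identityʳ 0ℚ)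
        ; Bμ-nonneg  = λ v v≢s l → subst (0ℚ ≤_) (sym (trans (Bμ-augmented v l) (rearranged v l (ζ-elsewhere l 0 (v≢s ∘ sym)))))
            (+-mono-≤ (Ω-within-buffer f 0≤u nonneg ≤cap p simple v l (Bμ-nonneg v v≢s l))
                      (*-nonneg 0≤u (*-nonneg (χ-nonneg (t ≟ v)) (χ-nonneg (T ℕ.≤? l)))))
        }
        where
        0≤u = <⇒≤ 0<u
        within = Δ-within-capacity f 0≤u nonneg ≤cap p simple
        rearranged : ∀ v l → ζ v l (s , 0) ≡ 0ℚ →
                     Bμ f v (suc l) + u * (ζ v l (t , T) - ζ v l (s , 0) + Ω f p v l)
                     ≡ Bμ f v (suc l) + u * Ω f p v l + u * ζ v l (t , T)
        rearranged v l ζ₀≡0 = trans (cong (λ z → Bμ f v (suc l) + u * (ζ v l (t , T) - z + Ω f p v l)) ζ₀≡0)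
          (solve 4 (λ b u z w → b :+ u :* (z :- con 0ℚ :+ w) := b :+ u :* w :+ u :* z) refl
            (Bμ f v (suc l)) u (ζ v l (t , T)) (Ω f p v l))

      augmented-invariant : Invariant augmented
      augmented-invariant = record
        { feasible = augmented-feasible
        ; integral = λ e j → multiple-+ (integral e j) (Δ-multiple f p e j)
        ; drained  = λ v v≢s v≢t → trans (Bμ-augmented v T)
            (trans (cong₂ _+_ (drained v v≢s v≢t)
                              (cong (u *_) (cong₂ _+_ (cong₂ _-_ (ζ-elsewhere T T (v≢t ∘ sym)) (ζ-elsewhere T 0 (v≢s ∘ sym)))
                                                      (Ω-at-lmax v))))
                   (solve 1 (λ u → con 0ℚ :+ u :* (con 0ℚ :- con 0ℚ :+ con 0ℚ) := con 0ℚ) refl u))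
        }

      augmented-value : B⁺ augmented t T ≡ B⁺ f t T + u
      augmented-value = begin
        B⁺ augmented t T                                                  ≡⟨ sym (Bμ-sink augmented T) ⟩
        Bμ augmented t (suc T)                                            ≡⟨ Bμ-augmented t T ⟩
        Bμ f t (suc T) + u * (ζ t T (t , T) - ζ t T (s , 0) + Ω f p t T) ≡⟨ cong₂ (λ b z → b + u * z) (Bμ-sink f T) once ⟩
        B⁺ f t T + u * 1ℚ                                                 ≡⟨ cong (B⁺ f t T +_) (*-identityʳ u) ⟩
        B⁺ f t T + u                                                      ∎
        where
        open ≡-Reasoning
        once : ζ t T (t , T) - ζ t T (s , 0) + Ω f p t T ≡ 1ℚ
        once = trans (cong₂ (λ z₁ z₀ → z₁ - z₀ + Ω f p t T)
                            (trans (cong₂ _*_ (χ-yes (t ≟ t) refl) (χ-yes (T ℕ.≤? T) ℕ.≤-refl)) (*-identityˡ 1ℚ))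
                            (ζ-elsewhere T 0 s≢t))
                     (cong (1ℚ - 0ℚ +_) (Ω-at-lmax t))

    -- Each augmentation adds u to a value bounded by B, so fuel enough to exceed B forces termination.
    iterate : ∀ (B : ℚ) → (∀ {f} → Invariant f → B⁺ f t T ≤ B) → ∀ fuel {f} → Invariant f →
              B < B⁺ f t T + fromℤ (ℤ.+ fuel) * u → Σ (Fin m → ℕ → ℚ) λ f → Invariant f × ¬ Reachable f (t , T)
    iterate B value≤B zero {f} inv B<v =
      ⊥-elim (<-irrefl refl (<-≤-trans (subst (B <_) (trans (cong (B⁺ f t T +_) (*-zeroˡ u)) (+-identityʳ _)) B<v) (value≤B inv)))
    iterate B value≤B (suc fuel) {f} inv B<v with reachable? f (t , T)
    ... | no unreachable = f , inv , unreachable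
    ... | yes (p , _) =
      let q , simple = loop-erase f p
          open Augmentation inv q simple
      in iterate B value≤B fuel augmented-invariant (subst (B <_) (regroup {B⁺ f t T} augmented-value) B<v)
      where
      regroup : ∀ {v v′} → v′ ≡ v + u → v + fromℤ (ℤ.+ suc fuel) * u ≡ v′ + fromℤ (ℤ.+ fuel) * u
      regroup {v} refl = trans (cong (λ k → v + k * u) (fromℤ-+ (ℤ.+ 1) (ℤ.+ fuel)))
        (solve 3 (λ v u k → v :+ (con 1ℚ :+ k) :* u := v :+ u :+ k :* u) refl v u (fromℤ (ℤ.+ fuel)))

    zero-invariant : Invariant (λ _ _ → 0ℚ)
    zero-invariant = record
      { feasible = record
        { nonneg     = λ _ _ → ≤-refl
        ; ≤cap       = λ e _ → <⇒≤ (c-pos e)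
        ; off-labels = λ _ _ _ → refl
        ; Bμ-nonneg  = λ v _ l → ≤-reflexive (sym (Bμ-0 v (suc l)))
        }
      ; integral = λ _ _ → multiple-0
      ; drained  = λ v _ _ → Bμ-0 v (suc T)
      }

    maximal-flow : (∀ e → IntMultiple u (c e)) → Σ (Fin m → ℕ → ℚ) λ f → Invariant f × ¬ Reachable f (t , T)
    maximal-flow c-multiple = iterate B value≤B (suc ℤ.∣ z ∣) zero-invariant start
      where
      B : ℚ
      B = capacity N timeEdges
      z : ℤ
      z = IntMultiple.coefficient (capacity-multiple c-multiple timeEdges)
      value≤B : ∀ {f} → Invariant f → B⁺ f t T ≤ B
      value≤B inv = weak-duality (temporalFlow (Invariant.feasible inv)) timeEdges-cut
      start : B < B⁺ (λ _ _ → 0ℚ) t T + fromℤ (ℤ.+ suc ℤ.∣ z ∣) * u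
      start = begin-strict
        B                                                  ≡⟨ IntMultiple.is-multiple (capacity-multiple c-multiple timeEdges) ⟩
        fromℤ z * u                                        <⟨ *-monoˡ-<-pos u {{ℚ.positive 0<u}} (fromℤ-mono-< (below-suc-∣∣ z)) ⟩
        fromℤ (ℤ.+ suc ℤ.∣ z ∣) * u                        ≡⟨ sym (trans (cong (_+ fromℤ (ℤ.+ suc ℤ.∣ z ∣) * u) (B⁺-0 t T)) (+-identityˡ _)) ⟩
        B⁺ (λ _ _ → 0ℚ) t T + fromℤ (ℤ.+ suc ℤ.∣ z ∣) * u ∎
        where
        open ≤-Reasoning
        below-suc-∣∣ : ∀ z → z ℤ.< ℤ.+ suc ℤ.∣ z ∣
        below-suc-∣∣ (ℤ.+ k)    = ℤ.+<+ (ℕ.n<1+n k)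
        below-suc-∣∣ ℤ.-[1+ k ] = ℤ.-<+

  -- The cut left by the final residual network

  module ResidualCut (u : ℚ) (0<u : 0ℚ < u) (c-multiple : ∀ e → IntMultiple u (c e))
                     {f : Fin m → ℕ → ℚ} (inv : FordFulkerson.Invariant u 0<u f)
                     (t-unreachable : ¬ Residual.Reachable u f (t , lmax N)) where
    open Residual u f
    open FordFulkerson.Invariant inv
    open Feasible feasible

    T : ℕ
    T = lmax N

    reachable-later : ∀ {v l l′} → Reachable (v , l) → l ℕ.≤ l′ → l′ ℕ.≤ T → Reachable (v , l′)
    reachable-later {l′ = zero}  r z≤n _ = r
    reachable-later {l′ = suc k} r l≤ k<T with ℕ.m≤n⇒m<n∨m≡n l≤
    ... | inj₂ refl      = r
    ... | inj₁ (s≤s l≤k) = reachable-step (reachable-later r l≤k (ℕ.<⇒≤ k<T)) (wait k<T)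

    source-reachable : ∀ {l} → l ℕ.≤ T → Reachable (s , l)
    source-reachable = reachable-later reachable-source z≤n

    private
      mutual
        B⁺-multiple : ∀ v l → IntMultiple u (B⁺ f v l)
        B⁺-multiple v zero    = multiple-0
        B⁺-multiple v (suc l) = multiple-+ (Bμ-multiple v l) (flowAt-multiple tgt v (suc l))

        Bμ-multiple : ∀ v l → IntMultiple u (Bμ f v (suc l))
        Bμ-multiple v l = multiple-- (B⁺-multiple v l) (flowAt-multiple src v (suc l))

        flowAt-multiple : ∀ end v l → IntMultiple u (flowAt end f v l)
        flowAt-multiple end v l = multiple-sum λ e → multiple-χ* (end e ≟ v) (integral e l)

      -- Residual capacities are multiples of u, so a residual arc missing from the network is exhausted.
      exhausted : ∀ {q} → IntMultiple u q → 0ℚ ≤ q → ¬ (u ≤ q) → q ≡ 0ℚ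
      exhausted q-multiple 0≤q u≰q = multiple<unit⇒0 0<u q-multiple 0≤q (≰⇒> u≰q)

      saturated : ∀ e j → ¬ (f e j + u ≤ c e) → f e j ≡ c e
      saturated e j no-room = begin
        f e j                  ≡⟨ sym (+-identityʳ (f e j)) ⟩
        f e j + 0ℚ             ≡⟨ cong (f e j +_) (sym residual≡0) ⟩
        f e j + (c e - f e j)  ≡⟨ f+[c-f]≡c ⟩
        c e                    ∎
        where
        open ≡-Reasoning
        f+[c-f]≡c : f e j + (c e - f e j) ≡ c e
        f+[c-f]≡c = solve 2 (λ c f → f :+ (c :- f) := c) refl (c e) (f e j)
        residual≡0 : c e - f e j ≡ 0ℚ
        residual≡0 = exhausted (multiple-- (c-multiple e) (integral e j)) (p≤q⇒0≤q-p (≤cap e j))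
                       (λ u≤c-f → no-room (subst (f e j + u ≤_) f+[c-f]≡c (+-monoʳ-≤ (f e j) u≤c-f)))

      empty : ∀ e j → ¬ (u ≤ f e j) → f e j ≡ 0ℚ
      empty e j = exhausted (integral e j) (nonneg e j)

      buffer-empty : ∀ {v} l → v ≢ s → ¬ (u ≤ Bμ f v (suc l)) → Bμ f v (suc l) ≡ 0ℚ
      buffer-empty {v} l v≢s = exhausted (Bμ-multiple v l) (Bμ-nonneg v v≢s l)

    Crossing : TimeEdge N → Set
    Crossing (e , l) = Reachable (src e , ℕ.pred l) × ¬ Reachable (tgt e , l)

    crossing? : ∀ x → Dec (Crossing x)
    crossing? (e , l) = reachable? (src e , ℕ.pred l) ×-dec ¬? (reachable? (tgt e , l))

    S : List (TimeEdge N)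
    S = filter crossing? timeEdges

    S-set : TimeEdgeSet N S
    S-set = filter⁺ crossing? (proj₁ timeEdges-set) , All.tabulate λ x∈S → All.lookup (proj₂ timeEdges-set) (proj₁ (∈-filter⁻ crossing? x∈S))

    ∈S⁺ : ∀ {e l} → suc l ∈ L e → Reachable (src e , l) → ¬ Reachable (tgt e , suc l) → (e , suc l) ∈ S
    ∈S⁺ l∈ r ¬r = ∈-filter⁺ crossing? (∈-timeEdges l∈) (r , ¬r)

    ∈S⁻ : ∀ {x} → x ∈ S → Crossing x
    ∈S⁻ x∈S = proj₂ (∈-filter⁻ crossing? {xs = timeEdges} x∈S)

    S-cut : IsTemporalCut N S
    S-cut = S-set , λ _ journey → crosses journey z≤n reachable-source
      where
      crosses : ∀ {v l js} → JourneyToT N v l js → l ℕ.≤ T → Reachable (v , l) → Σ (TimeEdge N) λ x → x ∈ js × x ∈ S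
      crosses arrive l≤T r = ⊥-elim (t-unreachable (reachable-later r l≤T ℕ.≤-refl))
      crosses (step {l = l} {e = e} {l' = suc k} refl l∈ (s≤s l≤k) journey) _ r with reachable? (tgt e , suc k)
      ... | no ¬r = (e , suc k) , here refl , ∈S⁺ l∈ (reachable-later r l≤k (ℕ.≤-trans (ℕ.n≤1+n k) (label≤lmax l∈))) ¬r
      ... | yes r′ with x , x∈js , x∈S ← crosses journey (label≤lmax l∈) r′ = x , there x∈js , x∈S

    α : Fin n → ℕ → ℚ
    α v l = χ (¬? (reachable? (v , l)))

    open Potential (temporalFlow feasible) α

    private
      outside-S : ∀ {e l} → (e , suc l) ∉ S → χ ((e , suc l) ∈ᵗ? S) * c e ≡ 0ℚ
      outside-S {e} {l} ∉S = trans (cong (_* c e) (χ-no ((e , suc l) ∈ᵗ? S) ∉S)) (*-zeroˡ (c e))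

      unused : ∀ e l → (suc l ∈ L e → ¬ (u ≤ f e (suc l))) → f e (suc l) ≡ 0ℚ
      unused e l no-flow with suc l ∈ℕ? L e
      ... | yes l∈ = empty e (suc l) (no-flow l∈)
      ... | no l∉  = off-labels e (suc l) (inj₂ l∉)

    gain-at : ∀ l → suc l ℕ.≤ T → ∀ e → f e (suc l) * (α (tgt e) (suc l) - α (src e) l) ≡ χ ((e , suc l) ∈ᵗ? S) * c e
    gain-at l l<T e with reachable? (src e , l) | reachable? (tgt e , suc l)
    ... | yes r | no ¬r′ with suc l ∈ℕ? L e
    ...   | yes l∈ = trans (cong (_* (1ℚ - 0ℚ)) (saturated e (suc l) λ room → ¬r′ (reachable-step r (push l∈ room))))
                       (trans (*-identityʳ (c e)) (sym (trans (cong (_* c e) (χ-yes (_ ∈ᵗ? S) (∈S⁺ l∈ r ¬r′))) (*-identityˡ (c e)))))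
    ...   | no l∉  = trans (cong (_* (1ℚ - 0ℚ)) (off-labels e (suc l) (inj₂ l∉)))
                       (trans (*-zeroˡ (1ℚ - 0ℚ)) (sym (outside-S (l∉ ∘ All.lookup (proj₂ S-set)))))
    gain-at l l<T e | no ¬r | yes r′ =
      trans (cong (_* (0ℚ - 1ℚ)) (unused e l λ l∈ carried → ¬r (reachable-step r′ (pull l∈ carried))))
            (trans (*-zeroˡ (0ℚ - 1ℚ)) (sym (outside-S (¬r ∘ proj₁ ∘ ∈S⁻))))
    gain-at l l<T e | yes _ | yes r′ = trans (*-zeroʳ (f e (suc l))) (sym (outside-S λ x∈S → proj₂ (∈S⁻ x∈S) r′))
    gain-at l l<T e | no ¬r | no _   = trans (*-zeroʳ (f e (suc l))) (sym (outside-S (¬r ∘ proj₁ ∘ ∈S⁻)))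

    loss-at : ∀ l → suc l ℕ.≤ T → ∀ v → (α v l - α v (suc l)) * Bμ f v (suc l) ≡ 0ℚ
    loss-at l l<T v with reachable? (v , l) | reachable? (v , suc l)
    ... | yes _ | yes _   = *-zeroˡ (Bμ f v (suc l))
    ... | no _  | no _    = *-zeroˡ (Bμ f v (suc l))
    ... | yes r | no ¬r′  = ⊥-elim (¬r′ (reachable-step r (wait l<T)))
    ... | no ¬r | yes r′  = trans (cong ((1ℚ - 0ℚ) *_) (buffer-empty l v≢s λ held → ¬r (reachable-step r′ (unwait held))))
                                  (*-zeroʳ (1ℚ - 0ℚ))
      where
      v≢s : v ≢ s
      v≢s refl = ¬r (source-reachable (ℕ.<⇒≤ l<T))

    value≡capacity : value N (temporalFlow feasible) ≡ capacity N S
    value≡capacity = begin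
      value N (temporalFlow feasible)                    ≡⟨ value≡∑gain source-dead sink-alive others-empty ⟩
      ∑[ l < T ] (edgeGain (toℕ l) - bufferLoss (toℕ l)) ≡⟨ sum-cong-≗ {T} per-step ⟩
      ∑[ l < T ] capacityAt S (toℕ l)                    ≡⟨ sym (capacity≡∑capacityAt S-set) ⟩
      capacity N S                                       ∎
      where
      open ≡-Reasoning
      source-dead : ∀ l → l ℕ.≤ T → α s l ≡ 0ℚ
      source-dead l l≤T = χ-no (¬? (reachable? (s , l))) (λ ¬r → ¬r (source-reachable l≤T))
      sink-alive : α t T ≡ 1ℚ
      sink-alive = χ-yes (¬? (reachable? (t , T))) t-unreachable
      per-step : ∀ (l : Fin T) → edgeGain (toℕ l) - bufferLoss (toℕ l) ≡ capacityAt S (toℕ l)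
      per-step l = trans (cong₂ _-_ (sum-cong-≗ (gain-at (toℕ l) (Fin.toℕ<n l))) (sum-zero (loss-at (toℕ l) (Fin.toℕ<n l))))
                         (+-identityʳ (capacityAt S (toℕ l)))
      others-empty : ∀ v → v ≢ t → α v T * B⁺ f v T ≡ 0ℚ
      others-empty v v≢t with v ≟ s
      ... | yes refl = trans (cong (_* B⁺ f s T) (source-dead T ℕ.≤-refl)) (*-zeroˡ (B⁺ f s T))
      ... | no v≢s   = trans (cong (α v T *_) (trans (sym (Bμ≡B⁺ f v T no-out)) (drained v v≢s v≢t))) (*-zeroʳ (α v T))
        where
        no-out : Out f v (suc T) ≡ 0ℚ
        no-out = sum-zero λ e → trans (cong (χ (src e ≟ v) *_) (off-labels e (suc T) (inj₂ (ℕ.<-irrefl refl ∘ label≤lmax))))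
                                      (*-zeroʳ (χ (src e ≟ v)))

  equal-flow-and-cut : Σ (TemporalFlow N) λ F → Σ (List (TimeEdge N)) λ S → IsTemporalCut N S × value N F ≡ capacity N S
  equal-flow-and-cut =
    let u , 0<u , c-multiple     = commonUnit c
        f , inv , t-unreachable = FordFulkerson.maximal-flow u 0<u c-multiple
        open ResidualCut u 0<u c-multiple inv t-unreachable
    in  temporalFlow (FordFulkerson.Invariant.feasible inv) , S , S-cut , value≡capacity

  equal-value⇒optimal : ∀ {F S} → IsTemporalCut N S → value N F ≡ capacity N S →
                        ((G : TemporalFlow N) → value N G ≤ value N F)
                        × IsMinimalTemporalCut N S
                        × ((S′ : List (TimeEdge N)) → IsTemporalCut N S′ → capacity N S ≤ capacity N S′)
  equal-value⇒optimal {F} {S} cut F≡S = maximum , minimum⇒minimal cut minimum , minimum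
    where
    maximum : (G : TemporalFlow N) → value N G ≤ value N F
    maximum G = subst (value N G ≤_) (sym F≡S) (weak-duality G cut)
    minimum : (S′ : List (TimeEdge N)) → IsTemporalCut N S′ → capacity N S ≤ capacity N S′
    minimum S′ cut′ = subst (_≤ capacity N S′) F≡S (weak-duality F cut′)

theorem1 : (N : TemporalNetwork) →
    Σ (TemporalFlow N) (λ F → Σ (List (TimeEdge N)) (λ S →
        ((G : TemporalFlow N) → value N G ≤ value N F)
      × IsMinimalTemporalCut N S
      × ((S' : List (TimeEdge N)) → IsTemporalCut N S' → capacity N S ≤ capacity N S')
      × value N F ≡ capacity N S))
theorem1 N =
  let F , S , cut , F≡S            = equal-flow-and-cut N
      maximum , minimal , minimum = equal-value⇒optimal N {F} {S} cut F≡S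
  in  F , S , maximum , minimal , minimum , F≡S
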